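{- Let $n\ge0$, $\pi\in S_n(132)$, and let $\mu$ be defined below. Then $$\bigl(C(\mu(\pi)),\,\mathsf{des}(\mu(\pi)),\,L(\mu(\pi))\bigr)=\bigl(B(\pi),\,\mathsf{des}(\pi),\,L(\pi)\bigr).$$
   Context: $S_n$ is the set of permutations of $\{1,\dots,n\}$ in one-line notation $\pi=\pi_1\cdots\pi_n$; $S_n(132)$ those avoiding the classical pattern $132$. Statistics: $\mathsf{des}(\pi)=\mathrm{card}\{i<n:\pi_i>\pi_{i+1}\}$; $B(\pi)=\mathrm{card}\{(i,j):1\le i<j\le n-1,\ \pi_j<\pi_i<\pi_{j+1}\}$ (vincular pattern $2\text{ - }\underline{13}$); $C(\pi)=\mathrm{card}\{(i,k):1\le i,\ i+1<k\le n,\ \pi_{i+1}<\pi_i<\pi_k\}$ (vincular pattern $\underline{21}\text{ - }3$); $L(\pi)=\mathrm{card}\{i<n:\pi_i<\pi_n\}=\pi_n-1$ for $n\ge1$, and all statistics are $0$ on the empty permutation $\varepsilon$. For permutations $\alpha$ (length $a$), $\beta$ (length $b$): $\alpha\oplus\beta$ has entries $\alpha_i$ ($i\le a$) and $\beta_{i-a}+a$ ($i>a$); $\alpha\ominus\beta$ has entries $\alpha_i+b$ ($i\le a$) and $\beta_{i-a}$ ($i>a$); $1$ is the length-one permutation. A nonempty $132$-avoiding permutation can be written uniquely as $(\alpha\oplus1)\ominus\beta$ and also uniquely as $\alpha\ominus(\beta\oplus1)$, with $\alpha,\beta$ possibly empty $132$-avoiding. Map $\psi$ (a bijection of each $S_n(132)$;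 set $\psi(\varepsilon)=\varepsilon$): $\psi(1)=1$; for $\pi\in S_n(132)$, $n\ge2$: (i) if $\pi=1\ominus\alpha$, $\psi(\pi)=1\ominus\psi(\alpha)$; (ii) if $\pi=(\alpha\oplus1)\ominus\beta$ with $\alpha,\beta$ nonempty, write $\psi(\beta)=\gamma\ominus(\delta\oplus1)$ and set $\psi(\pi)=((\psi(\alpha)\ominus(\delta\oplus1))\oplus1)\ominus\gamma$; (iii) if $\pi=\alpha\oplus1$ with $\alpha$ nonempty, write $\psi(\alpha)=(\gamma\oplus1)\ominus\delta$ and set $\psi(\pi)=((\gamma\oplus1)\oplus1)\ominus\delta$. Map $\mu$: $\mu(\varepsilon)=\varepsilon$, and for nonempty $\pi=\alpha\ominus(\beta\oplus1)$ in $S_n(132)$, $\mu(\pi)=\mu(\alpha)\ominus(\mu(\psi(\beta))\oplus1)$. -}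

module Defs where

open import Data.Nat using (ℕ; zero; suc; _+_; _∸_; _<ᵇ_; _≡ᵇ_; _<_; _≤_)
open import Data.Bool using (Bool; true; false; if_then_else_; _∧_)
open import Data.List using (List; []; _∷_; _++_; map; length; upTo; filterᵇ; last)
open import Data.Maybe using (Maybe; just; nothing)
open import Data.Product using (_×_; _,_; proj₁; proj₂; ∃)
open import Data.List.Relation.Binary.Permutation.Propositional using (_↭_)
open import Relation.Nullary using (¬_)

-- Permutations are lists in one-line notation (values 1..n).

-- 1-indexed entry π_i (0 for out-of-range indices).
at : List ℕ → ℕ → ℕ
at xs zero = 0
at [] (suc i) = 0
at (x ∷ xs) (suc zero) = x
at (x ∷ xs) (suc (suc i)) = at xs (suc i)

IsPerm : ℕ → List ℕ → Set
IsPerm n π = π ↭ map suc (upTo n)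

Avoids132 : List ℕ → Set
Avoids132 π = ¬ (∃ λ i → ∃ λ j → ∃ λ k →
  (1 ≤ i) × (i < j) × (j < k) × (k ≤ length π) × (at π i < at π k) × (at π k < at π j))

card : ℕ → (ℕ → Bool) → ℕ
card zero p = 0
card (suc m) p = card m p + (if p (suc m) then 1 else 0)

sumTo : ℕ → (ℕ → ℕ) → ℕ
sumTo zero f = 0
sumTo (suc m) f = sumTo m f + f (suc m)

des : List ℕ → ℕ
des π = card (length π ∸ 1) (λ i → at π (suc i) <ᵇ at π i)

-- B(π) = #{ (i,j) : 1 ≤ i < j ≤ n-1, π_j < π_i < π_{j+1} }
B : List ℕ → ℕ
B π = sumTo (length π ∸ 1) (λ j → card (j ∸ 1) (λ i →
        (at π j <ᵇ at π i) ∧ (at π i <ᵇ at π (suc j))))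

-- C(π) = #{ (i,k) : 1 ≤ i, i+1 < k ≤ n, π_{i+1} < π_i < π_k }
C : List ℕ → ℕ
C π = sumTo (length π) (λ k → card (k ∸ 2) (λ i →
        (at π (suc i) <ᵇ at π i) ∧ (at π i <ᵇ at π k)))

L : List ℕ → ℕ
L π = card (length π ∸ 1) (λ i → at π i <ᵇ at π (length π))

one : List ℕ
one = 1 ∷ []

_⊕_ : List ℕ → List ℕ → List ℕ
α ⊕ β = α ++ map (_+ length α) β

_⊖_ : List ℕ → List ℕ → List ℕ
α ⊖ β = map (_+ length β) α ++ β

infixl 6 _⊕_ _⊖_

-- Decomposition of a nonempty 132-avoiding π as α ⊖ (β ⊕ 1):
-- with m = π_n, β consists of the entries < m, α of the entries > m (shifted down by m).
lastOr0 : List ℕ → ℕ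
lastOr0 xs with last xs
... | just x = x
... | nothing = 0

decompR : List ℕ → List ℕ × List ℕ
decompR π = map (_∸ m) (filterᵇ (m <ᵇ_) π) , filterᵇ (_<ᵇ m) π
  where m = lastOr0 π

splitAt-val : ℕ → List ℕ → List ℕ × List ℕ
splitAt-val v [] = [] , []
splitAt-val v (x ∷ xs) = if x ≡ᵇ v then ([] , xs)
  else (x ∷ proj₁ (splitAt-val v xs) , proj₂ (splitAt-val v xs))

-- Decomposition of a nonempty 132-avoiding π ∈ S_n as (α ⊕ 1) ⊖ β:
-- the 1 is the entry n; α = entries before n (shifted down by |β|), β = entries after n.
decompL : List ℕ → List ℕ × List ℕ
decompL π = map (_∸ length b) a , b
  where
    a = proj₁ (splitAt-val (length π) π)
    b = proj₂ (splitAt-val (length π) π)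

-- ψ, with a fuel argument (fuel = length suffices, since recursive calls are on
-- strictly shorter permutations)
ψ-case : (List ℕ → List ℕ) → List ℕ → List ℕ → List ℕ
-- case (i): π = 1 ⊖ α   (includes π = 1)
ψ-case rec [] b = one ⊖ rec b
-- case (iii): π = α ⊕ 1, α nonempty; ψ(α) = (γ ⊕ 1) ⊖ δ
ψ-case rec (x ∷ α) [] = ((proj₁ (decompL (rec (x ∷ α))) ⊕ one) ⊕ one) ⊖ proj₂ (decompL (rec (x ∷ α)))
-- case (ii): π = (α ⊕ 1) ⊖ β, α, β nonempty; ψ(β) = γ ⊖ (δ ⊕ 1)
ψ-case rec (x ∷ α) (y ∷ β) =
  ((rec (x ∷ α) ⊖ (proj₂ (decompR (rec (y ∷ β))) ⊕ one)) ⊕ one) ⊖ proj₁ (decompR (rec (y ∷ β)))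

ψF : ℕ → List ℕ → List ℕ
ψF zero π = π
ψF (suc f) [] = []
ψF (suc f) (x ∷ π) = ψ-case (ψF f) (proj₁ (decompL (x ∷ π))) (proj₂ (decompL (x ∷ π)))

ψ : List ℕ → List ℕ
ψ π = ψF (length π) π

-- μ(ε) = ε ; μ(α ⊖ (β ⊕ 1)) = μ(α) ⊖ (μ(ψ(β)) ⊕ 1), again with fuel
μF : ℕ → List ℕ → List ℕ
μF zero π = π
μF (suc f) [] = []
μF (suc f) (x ∷ π) =
  μF f (proj₁ (decompR (x ∷ π))) ⊖ (μF f (ψ (proj₂ (decompR (x ∷ π)))) ⊕ one)

μ : List ℕ → List ℕ
μ π = μF (length π) π

module Submission where

-- Write ⊖ for the skew sum and note that the 132-avoiding
-- permutations are exactly the lists generated from [] by (a , b) ↦ a ⊖ (b ⊕ 1)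
-- (the family Gen).  We work with structurally recursive versions desᴸ, Bᴸ, Cᴸ
-- of the statistics, shown equal to the index-based ones of Defs, and with the
-- auxiliary statistic exceedLast p = #{ entries exceeding the last entry }.
--  1. Additivity laws: for lists with values in [1, length] (true of all of Gen)
--     B, C are additive under ⊖, des is additive up to a junction descent, and
--     B (a ⊕ 1) = B a + exceedLast a,  C (a ⊕ 1) = C a + des a,
--     L (a ⊖ (b ⊕ 1)) = length b.
--  2. The decompositions decompR / decompL of Defs recover a, b from
--     a ⊖ (b ⊕ 1) and (a ⊕ 1) ⊖ b, and every member of Gen has both forms.
--  3. ψ preserves Gen, length and des, and B (ψ p) + des p = B p + exceedLast p,
--     by induction following the three cases of its definition.
--  4. μ preserves Gen, length, des and L and sends B to C: by 1 and 3,
--     C (μ a ⊖ (μ (ψ b) ⊕ 1)) = B a + B (ψ b) + des b = B (a ⊖ (b ⊕ 1)).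
--  5. Every 132-avoiding arrangement of 1, …, n lies in Gen: split it at its
--     last entry m into the entries above m and those below m.
-- theorem3 combines 5, 4 and the agreement of the two versions of each statistic.

open import Defs
open import Data.Bool using (Bool; true; false; if_then_else_; _∧_; T; T?)
open import Data.Bool.Properties using (∧-zeroʳ; ∧-identityʳ)
open import Data.Empty using (⊥; ⊥-elim)
open import Data.List
  using (List; []; _∷_; _++_; map; length; filterᵇ; last; upTo; applyUpTo; initLast; _∷ʳ′_)
open import Data.List.Properties
  using (length-++; length-map; map-++; ++-assoc; ++-identityʳ;
         filter-all; filter-none; filter-++; filter-accept; filter-reject)
open import Data.List.Relation.Unary.All as All using (All; []; _∷_)
import Data.List.Relation.Unary.All.Properties as AllP
open import Data.List.Relation.Unary.Any as Any using ()
open import Data.List.Membership.Propositional using (_∈_; _∉_)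
open import Data.List.Membership.Propositional.Properties using (∈-++⁺ˡ; ∈-++⁺ʳ; ∈-map⁻)
open import Data.List.Relation.Unary.Unique.Propositional using (Unique)
open import Data.List.Relation.Unary.Unique.Propositional.Properties as Unique
  using (Unique[x∷xs]⇒x∉xs; upTo⁺)
open import Data.List.Relation.Binary.Permutation.Propositional using (_↭_; ↭-sym; ↭⇒↭ₛ)
open import Data.List.Relation.Binary.Permutation.Propositional.Properties
  using (∷↭∷ʳ; filter-↭; map⁺; ↭-length; ↭-empty-inv; All-resp-↭; ∈-resp-↭)
open import Data.Maybe using (just)
open import Data.Nat using (ℕ; zero; suc; _+_; _∸_; _<ᵇ_; _≡ᵇ_; _<_; _≤_; z≤n; s≤s)
open import Data.Nat.Properties
open import Data.Nat.Solver using (module +-*-Solver)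
open import Data.Product using (Σ; _×_; _,_; proj₁; proj₂)
open import Function using (_∘_)
open import Relation.Binary.Definitions using (tri<; tri≈; tri>)
open import Relation.Binary.PropositionalEquality
  using (_≡_; refl; sym; trans; cong; cong₂; subst; subst₂; setoid; module ≡-Reasoning)
open import Relation.Nullary using (¬_)
open import Data.List.Relation.Binary.Permutation.Setoid.Properties (setoid ℕ) using (Unique-resp-↭)
open import Algebra.Properties.CommutativeSemigroup +-commutativeSemigroup
  using (interchange; x∙yz≈y∙xz; xy∙z≈x∙zy)
open +-*-Solver using (solve; _:+_; con; _:=_)

⟦_⟧ : Bool → ℕ
⟦ b ⟧ = if b then 1 else 0

-- Peeling off the first index of the finite counts and sums of Defs; this is
-- what connects the index-based statistics to recursion on lists.
card-suc : ∀ m p → card (suc m) p ≡ ⟦ p 1 ⟧ + card m (λ i → p (suc i))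
card-suc zero p = +-comm 0 ⟦ p 1 ⟧
card-suc (suc m) p =
  trans (cong (_+ ⟦ p (suc (suc m)) ⟧) (card-suc m p)) (+-assoc ⟦ p 1 ⟧ _ _)

card-cong : ∀ m {p q : ℕ → Bool} → (∀ i → p (suc i) ≡ q (suc i)) → card m p ≡ card m q
card-cong zero e = refl
card-cong (suc m) e = cong₂ _+_ (card-cong m e) (cong ⟦_⟧ (e m))

sumTo-suc : ∀ m f → sumTo (suc m) f ≡ f 1 + sumTo m (λ i → f (suc i))
sumTo-suc zero f = +-comm 0 (f 1)
sumTo-suc (suc m) f =
  trans (cong (_+ f (suc (suc m))) (sumTo-suc m f)) (+-assoc (f 1) _ _)

sumTo-cong : ∀ m {f g : ℕ → ℕ} → (∀ i → f (suc i) ≡ g (suc i)) → sumTo m f ≡ sumTo m g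
sumTo-cong zero e = refl
sumTo-cong (suc m) e = cong₂ _+_ (sumTo-cong m e) (e m)

sumTo-+ : ∀ m f g → sumTo m (λ j → f j + g j) ≡ sumTo m f + sumTo m g
sumTo-+ zero f g = refl
sumTo-+ (suc m) f g =
  trans (cong (_+ (f (suc m) + g (suc m))) (sumTo-+ m f g))
        (interchange (sumTo m f) (sumTo m g) (f (suc m)) (g (suc m)))

sumTo-zero : ∀ m → sumTo m (λ _ → 0) ≡ 0
sumTo-zero zero = refl
sumTo-zero (suc m) = trans (+-identityʳ _) (sumTo-zero m)

-- desFrom x s = des (x ∷ s).
desFrom : ℕ → List ℕ → ℕ
desFrom x [] = 0
desFrom x (y ∷ t) = ⟦ y <ᵇ x ⟧ + desFrom y t

desᴸ : List ℕ → ℕ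
desᴸ [] = 0
desᴸ (x ∷ s) = desFrom x s

straddle : ℕ → ℕ → List ℕ → ℕ
straddle x y [] = 0
straddle x y (z ∷ t) = ⟦ (y <ᵇ x) ∧ (x <ᵇ z) ⟧ + straddle x z t

straddles : ℕ → List ℕ → ℕ
straddles x [] = 0
straddles x (y ∷ t) = straddle x y t

-- B counts, for each entry, the later adjacent pairs it straddles.
Bᴸ : List ℕ → ℕ
Bᴸ [] = 0
Bᴸ (x ∷ s) = straddles x s + Bᴸ s

above : ℕ → List ℕ → ℕ
above x [] = 0
above x (z ∷ t) = ⟦ x <ᵇ z ⟧ + above x t

-- CFrom x s = C (x ∷ s): every descent y < x contributes the later entries above x.
CFrom : ℕ → List ℕ → ℕ
CFrom x [] = 0
CFrom x (y ∷ t) = (if y <ᵇ x then above x t else 0) + CFrom y t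

Cᴸ : List ℕ → ℕ
Cᴸ [] = 0
Cᴸ (x ∷ s) = CFrom x s

below : ℕ → List ℕ → ℕ
below w [] = 0
below w (z ∷ t) = ⟦ z <ᵇ w ⟧ + below w t

des≡desᴸ : ∀ p → des p ≡ desᴸ p
des≡desᴸ [] = refl
des≡desᴸ (x ∷ s) = go x s
  where
  go : ∀ x s → des (x ∷ s) ≡ desFrom x s
  go x [] = refl
  go x (y ∷ t) = trans (card-suc (length t) _)
    (cong (⟦ y <ᵇ x ⟧ +_) (trans (card-cong (length t) (λ _ → refl)) (go y t)))

straddle≡sum : ∀ x y t →
  sumTo (length t) (λ j → ⟦ (at (y ∷ t) j <ᵇ x) ∧ (x <ᵇ at (y ∷ t) (suc j)) ⟧) ≡ straddle x y t
straddle≡sum x y [] = refl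
straddle≡sum x y (z ∷ t) = trans (sumTo-suc (length t) _)
  (cong (⟦ (y <ᵇ x) ∧ (x <ᵇ z) ⟧ +_)
    (trans (sumTo-cong (length t) (λ _ → refl)) (straddle≡sum x z t)))

B-cons : ∀ x s → B (x ∷ s) ≡ straddles x s + B s
B-cons x [] = refl
B-cons x (y ∷ t) = begin
    B (x ∷ y ∷ t)
  ≡⟨ sumTo-suc (length t) _ ⟩
    sumTo (length t) (λ j → term (suc j))
  ≡⟨ sumTo-cong (length t) split ⟩
    sumTo (length t) (λ j → first j + rest j)
  ≡⟨ sumTo-+ (length t) first rest ⟩
    sumTo (length t) first + B (y ∷ t)
  ≡⟨ cong (_+ B (y ∷ t)) (straddle≡sum x y t) ⟩
    straddle x y t + B (y ∷ t) ∎
  where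
  open ≡-Reasoning
  π : List ℕ
  π = x ∷ y ∷ t
  term : ℕ → ℕ
  term j = card (j ∸ 1) (λ i → (at π j <ᵇ at π i) ∧ (at π i <ᵇ at π (suc j)))
  ρ : List ℕ
  ρ = y ∷ t
  first : ℕ → ℕ
  first j = ⟦ (at ρ j <ᵇ x) ∧ (x <ᵇ at ρ (suc j)) ⟧
  rest : ℕ → ℕ
  rest j = card (j ∸ 1) (λ i → (at ρ j <ᵇ at ρ i) ∧ (at ρ i <ᵇ at ρ (suc j)))
  split : ∀ j → term (suc (suc j)) ≡ first (suc j) + rest (suc j)
  split j = trans (card-suc j _) (cong (first (suc j) +_) (card-cong j (λ _ → refl)))

B≡Bᴸ : ∀ p → B p ≡ Bᴸ p
B≡Bᴸ [] = refl
B≡Bᴸ (x ∷ s) = trans (B-cons x s) (cong (straddles x s +_) (B≡Bᴸ s))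

above≡sum : ∀ x t → sumTo (length t) (λ k → ⟦ x <ᵇ at t k ⟧) ≡ above x t
above≡sum x [] = refl
above≡sum x (z ∷ t) = trans (sumTo-suc (length t) _)
  (cong (⟦ x <ᵇ z ⟧ +_)
    (trans (sumTo-cong (length t) (λ { zero → refl ; (suc i) → refl })) (above≡sum x t)))

descent-contribution : ∀ x y t →
  sumTo (length t) (λ k → ⟦ (y <ᵇ x) ∧ (x <ᵇ at t k) ⟧) ≡ (if y <ᵇ x then above x t else 0)
descent-contribution x y t with y <ᵇ x
... | true = above≡sum x t
... | false = sumTo-zero (length t)

C≡Cᴸ : ∀ p → C p ≡ Cᴸ p
C≡Cᴸ [] = refl
C≡Cᴸ (x ∷ s) = go x s
  where
  go : ∀ x s → C (x ∷ s) ≡ CFrom x s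
  go x [] = refl
  go x (y ∷ t) = begin
      C (x ∷ y ∷ t)
    ≡⟨ trans (sumTo-suc (suc (length t)) _) (sumTo-suc (length t) _) ⟩
      sumTo (length t) (λ k → term (suc (suc k)))
    ≡⟨ sumTo-cong (length t) split ⟩
      sumTo (length t) (λ k → first k + rest (suc k))
    ≡⟨ sumTo-+ (length t) first (λ k → rest (suc k)) ⟩
      sumTo (length t) first + sumTo (length t) (λ k → rest (suc k))
    ≡⟨ cong₂ _+_ (descent-contribution x y t) (trans (sym (sumTo-suc (length t) rest)) (go y t)) ⟩
      CFrom x (y ∷ t) ∎
    where
    open ≡-Reasoning
    π : List ℕ
    π = x ∷ y ∷ t
    term : ℕ → ℕ
    term k = card (k ∸ 2) (λ i → (at π (suc i) <ᵇ at π i) ∧ (at π i <ᵇ at π k))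
    first : ℕ → ℕ
    first k = ⟦ (y <ᵇ x) ∧ (x <ᵇ at t k) ⟧
    ρ : List ℕ
    ρ = y ∷ t
    rest : ℕ → ℕ
    rest k = card (k ∸ 2) (λ i → (at ρ (suc i) <ᵇ at ρ i) ∧ (at ρ i <ᵇ at ρ k))
    split : ∀ k → term (suc (suc (suc k))) ≡ first (suc k) + rest (suc (suc k))
    split k = trans (card-suc k _) (cong (first (suc k) +_) (card-cong k (λ _ → refl)))

length-snoc : ∀ (q : List ℕ) w → length (q ++ w ∷ []) ≡ suc (length q)
length-snoc q w = trans (length-++ q) (+-comm (length q) 1)

at-snoc : ∀ q w → at (q ++ w ∷ []) (suc (length q)) ≡ w
at-snoc [] w = refl
at-snoc (x ∷ []) w = refl
at-snoc (x ∷ y ∷ q) w = at-snoc (y ∷ q) w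

L-snoc : ∀ q w → L (q ++ w ∷ []) ≡ below w q
L-snoc q w rewrite length-snoc q w | at-snoc q w = count q (w ∷ [])
  where
  count : ∀ q r → card (length q) (λ i → at (q ++ r) i <ᵇ w) ≡ below w q
  count [] r = refl
  count (x ∷ q) r = trans (card-suc (length q) _)
    (cong (⟦ x <ᵇ w ⟧ +_) (trans (card-cong (length q) (λ _ → refl)) (count q r)))

<ᵇ-true : ∀ {m n} → m < n → (m <ᵇ n) ≡ true
<ᵇ-true {zero} {suc n} _ = refl
<ᵇ-true {suc m} {suc n} (s≤s p) = <ᵇ-true p

<ᵇ-false : ∀ {m n} → n ≤ m → (m <ᵇ n) ≡ false
<ᵇ-false {m} {zero} _ = refl
<ᵇ-false {suc m} {suc n} (s≤s p) = <ᵇ-false p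

≡ᵇ-refl : ∀ m → (m ≡ᵇ m) ≡ true
≡ᵇ-refl zero = refl
≡ᵇ-refl (suc m) = ≡ᵇ-refl m

<⇒≡ᵇ-false : ∀ {m n} → m < n → (m ≡ᵇ n) ≡ false
<⇒≡ᵇ-false {zero} {suc n} _ = refl
<⇒≡ᵇ-false {suc m} {suc n} (s≤s p) = <⇒≡ᵇ-false p

-- Comparisons are invariant under a common shift, which is how ⊖ and ⊕ act.
<ᵇ-+ʳ : ∀ k m n → (m + k <ᵇ n + k) ≡ (m <ᵇ n)
<ᵇ-+ʳ k m n rewrite +-comm m k | +-comm n k = shiftˡ k
  where
  shiftˡ : ∀ k → (k + m <ᵇ k + n) ≡ (m <ᵇ n)
  shiftˡ zero = refl
  shiftˡ (suc k) = shiftˡ k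

length-⊖ : ∀ a b → length (a ⊖ b) ≡ length a + length b
length-⊖ a b = trans (length-++ (map _ a)) (cong (_+ length b) (length-map _ a))

length-⊕1 : ∀ a → length (a ⊕ one) ≡ suc (length a)
length-⊕1 a = trans (length-++ a) (+-comm (length a) 1)

length-⊖⊕1 : ∀ a b → length (a ⊖ (b ⊕ one)) ≡ length a + suc (length b)
length-⊖⊕1 a b = trans (length-⊖ a (b ⊕ one)) (cong (length a +_) (length-⊕1 b))

length-⊕1⊖ : ∀ a b → length ((a ⊕ one) ⊖ b) ≡ suc (length a + length b)
length-⊕1⊖ a b = trans (length-⊖ (a ⊕ one) b) (cong (_+ length b) (length-⊕1 a))

length-⊕1-pos : ∀ a → 0 < length (a ⊕ one)
length-⊕1-pos a = subst (0 <_) (sym (length-⊕1 a)) (s≤s z≤n)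

map-+-+ : ∀ j k xs → map (_+ k) (map (_+ j) xs) ≡ map (_+ (j + k)) xs
map-+-+ j k [] = refl
map-+-+ j k (x ∷ xs) = cong₂ _∷_ (+-assoc x j k) (map-+-+ j k xs)

map-+0 : ∀ xs → map (_+ 0) xs ≡ xs
map-+0 [] = refl
map-+0 (x ∷ xs) = cong₂ _∷_ (+-identityʳ x) (map-+0 xs)

map-+-∸ : ∀ k xs → map (_∸ k) (map (_+ k) xs) ≡ xs
map-+-∸ k [] = refl
map-+-∸ k (x ∷ xs) = cong₂ _∷_ (m+n∸n≡m x k) (map-+-∸ k xs)

⊖-identityʳ : ∀ a → a ⊖ [] ≡ a
⊖-identityʳ a = trans (++-identityʳ _) (map-+0 a)

⊖-assoc : ∀ a b c → (a ⊖ b) ⊖ c ≡ a ⊖ (b ⊖ c)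
⊖-assoc a b c = begin
    map (_+ length c) (map (_+ length b) a ++ b) ++ c
  ≡⟨ cong (_++ c) (map-++ _ (map _ a) b) ⟩
    (map (_+ length c) (map (_+ length b) a) ++ map (_+ length c) b) ++ c
  ≡⟨ ++-assoc (map _ (map _ a)) _ c ⟩
    map (_+ length c) (map (_+ length b) a) ++ (map (_+ length c) b ++ c)
  ≡⟨ cong (_++ (b ⊖ c)) (map-+-+ (length b) (length c) a) ⟩
    map (_+ (length b + length c)) a ++ (b ⊖ c)
  ≡⟨ cong (λ k → map (_+ k) a ++ (b ⊖ c)) (sym (length-⊖ b c)) ⟩
    a ⊖ (b ⊖ c) ∎
  where open ≡-Reasoning

-- Value bounds: a permutation of 1..n has all entries in [1, n].  All the
-- additivity laws below only need these bounds, not the permutation property.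
AllPos : List ℕ → Set
AllPos = All (1 ≤_)

AllLe : ℕ → List ℕ → Set
AllLe k = All (_≤ k)

AllLe-mono : ∀ {j k xs} → j ≤ k → AllLe j xs → AllLe k xs
AllLe-mono p = All.map (λ q → ≤-trans q p)

AllPos-⊖ : ∀ a b → AllPos a → AllPos b → AllPos (a ⊖ b)
AllPos-⊖ a b pa pb = AllP.++⁺ (AllP.map⁺ (All.map (λ {v} q → ≤-trans q (m≤m+n v _)) pa)) pb

AllLe-⊖ : ∀ a b → AllLe (length a) a → AllLe (length b) b → AllLe (length (a ⊖ b)) (a ⊖ b)
AllLe-⊖ a b la lb rewrite length-⊖ a b =
  AllP.++⁺ (AllP.map⁺ (All.map (+-monoˡ-≤ (length b)) la)) (AllLe-mono (m≤n+m (length b) (length a)) lb)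

AllPos-⊕1 : ∀ a → AllPos a → AllPos (a ⊕ one)
AllPos-⊕1 a pa = AllP.++⁺ pa (s≤s z≤n ∷ [])

AllLe-⊕1 : ∀ a → AllLe (length a) a → AllLe (length (a ⊕ one)) (a ⊕ one)
AllLe-⊕1 a la rewrite length-⊕1 a = AllP.++⁺ (AllLe-mono (n≤1+n _) la) (≤-refl ∷ [])

data Gen : List ℕ → Set where
  nil  : Gen []
  node : ∀ {a b} → Gen a → Gen b → Gen (a ⊖ (b ⊕ one))

Gen-bounds : ∀ {p} → Gen p → AllPos p × AllLe (length p) p
Gen-bounds nil = [] , []
Gen-bounds (node {a} {b} ga gb) with Gen-bounds ga | Gen-bounds gb
... | pa , la | pb , lb =
  AllPos-⊖ a (b ⊕ one) pa (AllPos-⊕1 b pb) , AllLe-⊖ a (b ⊕ one) la (AllLe-⊕1 b lb)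

Gen-pos : ∀ {p} → Gen p → AllPos p
Gen-pos g = proj₁ (Gen-bounds g)

Gen-le : ∀ {p} → Gen p → AllLe (length p) p
Gen-le g = proj₂ (Gen-bounds g)

Gen-⊖ : ∀ {a c} → Gen a → Gen c → Gen (a ⊖ c)
Gen-⊖ {a} ga nil = subst Gen (sym (⊖-identityʳ a)) ga
Gen-⊖ {a} ga (node {c} {d} gc gd) = subst Gen (⊖-assoc a c (d ⊕ one)) (node (Gen-⊖ ga gc) gd)

Gen-⊕1 : ∀ {a} → Gen a → Gen (a ⊕ one)
Gen-⊕1 ga = node nil ga

-- The two decompositions of a nonempty generated list, as Σ-types so that
-- they apply to lists that are not syntactically of the decomposed shape.
RightSplit : List ℕ → Set
RightSplit p = Σ (List ℕ) λ a → Σ (List ℕ) λ b → Gen a × Gen b × (p ≡ a ⊖ (b ⊕ one))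

LeftSplit : List ℕ → Set
LeftSplit p = Σ (List ℕ) λ a → Σ (List ℕ) λ b → Gen a × Gen b × (p ≡ (a ⊕ one) ⊖ b)

rightSplit : ∀ {p} → Gen p → 0 < length p → RightSplit p
rightSplit (node {a} {b} ga gb) _ = a , b , ga , gb , refl

-- Moving the maximum n to the front: a ⊖ (b ⊕ 1) = (a' ⊕ 1) ⊖ b', by
-- induction on a, using associativity of ⊖.
node-leftSplit : ∀ {a b} → Gen a → Gen b → LeftSplit (a ⊖ (b ⊕ one))
node-leftSplit {b = b} nil gb = b , [] , gb , nil , sym (⊖-identityʳ (b ⊕ one))
node-leftSplit {b = b} (node ga₁ ga₂) gb with node-leftSplit ga₁ ga₂
... | a' , b' , ga' , gb' , e = a' , b' ⊖ (b ⊕ one) , ga' , node gb' gb ,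
  trans (cong (_⊖ (b ⊕ one)) e) (⊖-assoc (a' ⊕ one) b' (b ⊕ one))

leftSplit : ∀ {p} → Gen p → 0 < length p → LeftSplit p
leftSplit (node ga gb) _ = node-leftSplit ga gb

filter-above-all : ∀ m {xs} → All (m <_) xs → filterᵇ (m <ᵇ_) xs ≡ xs
filter-above-all m = filter-all (λ v → T? (m <ᵇ v)) ∘ All.map <⇒<ᵇ

filter-above-none : ∀ m {xs} → All (_≤ m) xs → filterᵇ (m <ᵇ_) xs ≡ []
filter-above-none m =
  filter-none (λ v → T? (m <ᵇ v)) ∘ All.map (λ {v} q t → ≤⇒≯ q (<ᵇ⇒< m v t))

filter-below-all : ∀ m {xs} → All (_< m) xs → filterᵇ (_<ᵇ m) xs ≡ xs
filter-below-all m = filter-all (λ v → T? (v <ᵇ m)) ∘ All.map <⇒<ᵇ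

filter-below-none : ∀ m {xs} → All (m ≤_) xs → filterᵇ (_<ᵇ m) xs ≡ []
filter-below-none m =
  filter-none (λ v → T? (v <ᵇ m)) ∘ All.map (λ {v} q t → ≤⇒≯ q (<ᵇ⇒< v m t))

filterᵇ-++ : ∀ (p : ℕ → Bool) xs ys → filterᵇ p (xs ++ ys) ≡ filterᵇ p xs ++ filterᵇ p ys
filterᵇ-++ p = filter-++ (T? ∘ p)

last-snoc : ∀ (xs : List ℕ) v → last (xs ++ v ∷ []) ≡ just v
last-snoc [] v = refl
last-snoc (x ∷ []) v = refl
last-snoc (x ∷ y ∷ xs) v = last-snoc (y ∷ xs) v

lastOr0-snoc : ∀ xs v → lastOr0 (xs ++ v ∷ []) ≡ v
lastOr0-snoc xs v with last (xs ++ v ∷ []) | last-snoc xs v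
... | just .v | refl = refl

-- decompR recovers a and b from a ⊖ (b ⊕ 1): its last entry m = |b| + 1
-- separates the shifted copy of a (above m) from b (below m).
decompR-⊖⊕1 : ∀ a b → AllPos a → AllLe (length b) b → decompR (a ⊖ (b ⊕ one)) ≡ (a , b)
decompR-⊖⊕1 a b pa lb = trans (cong splitBy lastR) (cong₂ _,_ upper lower)
  where
  m : ℕ
  m = suc (length b)
  A : List ℕ
  A = map (_+ length (b ⊕ one)) a
  splitBy : ℕ → List ℕ × List ℕ
  splitBy x = map (_∸ x) (filterᵇ (x <ᵇ_) (A ++ b ⊕ one)) , filterᵇ (_<ᵇ x) (A ++ b ⊕ one)
  shape : a ⊖ (b ⊕ one) ≡ (A ++ b) ++ m ∷ []
  shape = sym (++-assoc A b (m ∷ []))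
  lastR : lastOr0 (a ⊖ (b ⊕ one)) ≡ m
  lastR = trans (cong lastOr0 shape) (lastOr0-snoc (A ++ b) m)
  bigA : All (m <_) A
  bigA = AllP.map⁺ (All.map (λ {v} q → subst (λ k → m < v + k) (sym (length-⊕1 b)) (+-monoˡ-≤ m q))
                               pa)
  small : All (_< m) b
  small = All.map s≤s lb
  upper : map (_∸ m) (filterᵇ (m <ᵇ_) (A ++ b ⊕ one)) ≡ a
  upper = begin
      map (_∸ m) (filterᵇ (m <ᵇ_) (A ++ b ⊕ one))
    ≡⟨ cong (map (_∸ m)) (filterᵇ-++ (m <ᵇ_) A (b ⊕ one)) ⟩
      map (_∸ m) (filterᵇ (m <ᵇ_) A ++ filterᵇ (m <ᵇ_) (b ⊕ one))
    ≡⟨ cong₂ (λ u v → map (_∸ m) (u ++ v)) (filter-above-all m bigA)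
         (filter-above-none m (AllP.++⁺ (All.map <⇒≤ small) (≤-refl ∷ []))) ⟩
      map (_∸ m) (A ++ [])
    ≡⟨ cong (map (_∸ m)) (++-identityʳ A) ⟩
      map (_∸ m) (map (_+ length (b ⊕ one)) a)
    ≡⟨ cong (λ k → map (_∸ m) (map (_+ k) a)) (length-⊕1 b) ⟩
      map (_∸ m) (map (_+ m) a)
    ≡⟨ map-+-∸ m a ⟩
      a ∎
    where open ≡-Reasoning
  lower : filterᵇ (_<ᵇ m) (A ++ b ⊕ one) ≡ b
  lower = begin
      filterᵇ (_<ᵇ m) (A ++ b ⊕ one)
    ≡⟨ filterᵇ-++ (_<ᵇ m) A (b ⊕ one) ⟩
      filterᵇ (_<ᵇ m) A ++ filterᵇ (_<ᵇ m) (b ⊕ one)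
    ≡⟨ cong₂ _++_ (filter-below-none m (All.map <⇒≤ bigA)) (filterᵇ-++ (_<ᵇ m) b (m ∷ [])) ⟩
      filterᵇ (_<ᵇ m) b ++ filterᵇ (_<ᵇ m) (m ∷ [])
    ≡⟨ cong₂ _++_ (filter-below-all m small) (filter-below-none m (≤-refl ∷ [])) ⟩
      b ++ []
    ≡⟨ ++-identityʳ b ⟩
      b ∎
    where open ≡-Reasoning

splitAt-val-++ : ∀ v xs ys → All (_< v) xs → splitAt-val v (xs ++ v ∷ ys) ≡ (xs , ys)
splitAt-val-++ v [] ys [] rewrite ≡ᵇ-refl v = refl
splitAt-val-++ v (x ∷ xs) ys (q ∷ qs) rewrite <⇒≡ᵇ-false q | splitAt-val-++ v xs ys qs = refl

decompL-⊕1⊖ : ∀ a b → AllLe (length a) a → decompL ((a ⊕ one) ⊖ b) ≡ (a , b)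
decompL-⊕1⊖ a b la =
  trans (cong unshift splits) (cong (_, b) (map-+-∸ (length b) a))
  where
  p : List ℕ
  p = (a ⊕ one) ⊖ b
  N : ℕ
  N = suc (length a) + length b
  unshift : List ℕ × List ℕ → List ℕ × List ℕ
  unshift (u , v) = map (_∸ length v) u , v
  shape : p ≡ map (_+ length b) a ++ N ∷ b
  shape = trans (cong (_++ b) (map-++ (_+ length b) a (suc (length a) ∷ [])))
    (++-assoc (map (_+ length b) a) _ b)
  splits : splitAt-val (length p) p ≡ (map (_+ length b) a , b)
  splits = trans (cong₂ splitAt-val (length-⊕1⊖ a b) shape)
    (splitAt-val-++ N (map (_+ length b) a) b
      (AllP.map⁺ (All.map (λ q → s≤s (+-monoˡ-≤ (length b) q)) la)))

lastOf : ℕ → List ℕ → ℕ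
lastOf x [] = x
lastOf x (y ∷ t) = lastOf y t

lastOf-∈ : ∀ {P : ℕ → Set} x s → All P (x ∷ s) → P (lastOf x s)
lastOf-∈ x [] (p ∷ _) = p
lastOf-∈ x (y ∷ t) (_ ∷ ps) = lastOf-∈ y t ps

lastOf-shift : ∀ k x s → lastOf (x + k) (map (_+ k) s) ≡ lastOf x s + k
lastOf-shift k x [] = refl
lastOf-shift k x (y ∷ t) = lastOf-shift k y t

lastOf-++ : ∀ x s y t → lastOf x (s ++ y ∷ t) ≡ lastOf y t
lastOf-++ x [] y t = refl
lastOf-++ x (z ∷ s) y t = lastOf-++ z s y t

-- exceedLast p: entries of p exceeding its last entry.  It is the correction
-- term in B (a ⊕ 1) = B a + exceedLast a.
exceedLastFrom : ℕ → List ℕ → ℕ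
exceedLastFrom x [] = 0
exceedLastFrom x (y ∷ t) = ⟦ lastOf y t <ᵇ x ⟧ + exceedLastFrom y t

exceedLast : List ℕ → ℕ
exceedLast [] = 0
exceedLast (x ∷ s) = exceedLastFrom x s

-- bothNonempty a b: a ⊖ b has a descent at the junction iff both parts are nonempty.
bothNonempty : List ℕ → List ℕ → ℕ
bothNonempty [] _ = 0
bothNonempty (_ ∷ _) [] = 0
bothNonempty (_ ∷ _) (_ ∷ _) = 1

desFrom-shift : ∀ k x s → desFrom (x + k) (map (_+ k) s) ≡ desFrom x s
desFrom-shift k x [] = refl
desFrom-shift k x (y ∷ t) = cong₂ _+_ (cong ⟦_⟧ (<ᵇ-+ʳ k y x)) (desFrom-shift k y t)

desFrom-++ : ∀ x s y t → desFrom x (s ++ y ∷ t) ≡ desFrom x s + ⟦ y <ᵇ lastOf x s ⟧ + desFrom y t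
desFrom-++ x [] y t = refl
desFrom-++ x (z ∷ s) y t = trans (cong (⟦ z <ᵇ x ⟧ +_) (desFrom-++ z s y t))
  (trans (sym (+-assoc ⟦ z <ᵇ x ⟧ _ _)) (cong (_+ desFrom y t) (sym (+-assoc ⟦ z <ᵇ x ⟧ _ _))))

desᴸ-⊖ : ∀ a b → AllPos a → AllLe (length b) b →
  desᴸ (a ⊖ b) ≡ desᴸ a + bothNonempty a b + desᴸ b
desᴸ-⊖ [] b pa lb = refl
desᴸ-⊖ (x ∷ s) [] pa lb =
  trans (cong desᴸ (⊖-identityʳ (x ∷ s))) (sym (trans (+-identityʳ _) (+-identityʳ _)))
desᴸ-⊖ (x ∷ s) (y ∷ t) (px ∷ ps) (ly ∷ lt) =
  trans (desFrom-++ (x + k) (map (_+ k) s) y t)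
    (cong (_+ desFrom y t) (cong₂ _+_ (desFrom-shift k x s) (cong ⟦_⟧ (<ᵇ-true junction))))
  where
  k : ℕ
  k = length (y ∷ t)
  junction : y < lastOf (x + k) (map (_+ k) s)
  junction = subst (y <_) (sym (lastOf-shift k x s))
    (≤-trans (s≤s ly) (+-monoˡ-≤ k (lastOf-∈ x s (px ∷ ps))))

desᴸ-snoc : ∀ a w → All (_< w) a → desᴸ (a ++ w ∷ []) ≡ desᴸ a
desᴸ-snoc [] w _ = refl
desᴸ-snoc (x ∷ s) w ps = trans (desFrom-++ x s w [])
  (trans (+-identityʳ _)
    (trans (cong (desFrom x s +_) (cong ⟦_⟧ (<ᵇ-false (<⇒≤ (lastOf-∈ x s ps))))) (+-identityʳ _)))

desᴸ-⊕1 : ∀ a → AllLe (length a) a → desᴸ (a ⊕ one) ≡ desᴸ a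
desᴸ-⊕1 a la = desᴸ-snoc a (suc (length a)) (All.map s≤s la)

straddle-below : ∀ v y t → All (_< v) t → straddle v y t ≡ 0
straddle-below v y [] _ = refl
straddle-below v y (z ∷ t) (q ∷ qs) =
  cong₂ _+_ (cong ⟦_⟧ (trans (cong ((y <ᵇ v) ∧_) (<ᵇ-false (<⇒≤ q))) (∧-zeroʳ _)))
            (straddle-below v z t qs)

straddles-++-below : ∀ v s b → All (_< v) b → straddles v (s ++ b) ≡ straddles v s
straddles-++-below v [] [] q = refl
straddles-++-below v [] (y ∷ t) (_ ∷ q) = straddle-below v y t q
straddles-++-below v (y ∷ t) b q = go y t
  where
  go : ∀ y t → straddle v y (t ++ b) ≡ straddle v y t
  go y [] = straddle-below v y b q
  go y (z ∷ t) = cong (_ +_) (go z t)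

straddles-shift : ∀ k x s → straddles (x + k) (map (_+ k) s) ≡ straddles x s
straddles-shift k x [] = refl
straddles-shift k x (y ∷ s) = go y s
  where
  go : ∀ y s → straddle (x + k) (y + k) (map (_+ k) s) ≡ straddle x y s
  go y [] = refl
  go y (z ∷ s) = cong₂ _+_ (cong ⟦_⟧ (cong₂ _∧_ (<ᵇ-+ʳ k y x) (<ᵇ-+ʳ k x z))) (go z s)

Bᴸ-shift-++ : ∀ k a b → AllPos a → AllLe k b → Bᴸ (map (_+ k) a ++ b) ≡ Bᴸ a + Bᴸ b
Bᴸ-shift-++ k [] b pa lb = refl
Bᴸ-shift-++ k (x ∷ s) b (px ∷ ps) lb =
  trans (cong₂ _+_
      (trans (straddles-++-below (x + k) (map (_+ k) s) b
               (All.map (λ q → ≤-trans (s≤s q) (+-monoˡ-≤ k px)) lb))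
             (straddles-shift k x s))
      (Bᴸ-shift-++ k s b ps lb))
    (sym (+-assoc (straddles x s) _ _))

Bᴸ-⊖ : ∀ a b → AllPos a → AllLe (length b) b → Bᴸ (a ⊖ b) ≡ Bᴸ a + Bᴸ b
Bᴸ-⊖ a b = Bᴸ-shift-++ (length b) a b

Bᴸ-snoc : ∀ a w → All (_< w) a → Bᴸ (a ++ w ∷ []) ≡ Bᴸ a + exceedLast a
Bᴸ-snoc [] w _ = refl
Bᴸ-snoc (x ∷ []) w _ = refl
Bᴸ-snoc (x ∷ y ∷ t) w (px ∷ ps) =
  trans (cong₂ _+_ (last-pair y t) (Bᴸ-snoc (y ∷ t) w ps)) (interchange (straddle x y t) _ _ _)
  where
  last-pair : ∀ y t → straddle x y (t ++ w ∷ []) ≡ straddle x y t + ⟦ lastOf y t <ᵇ x ⟧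
  last-pair y [] = trans (+-identityʳ _)
    (cong ⟦_⟧ (trans (cong ((y <ᵇ x) ∧_) (<ᵇ-true px)) (∧-identityʳ _)))
  last-pair y (z ∷ t) =
    trans (cong (_ +_) (last-pair z t)) (sym (+-assoc ⟦ (y <ᵇ x) ∧ (x <ᵇ z) ⟧ _ _))

Bᴸ-⊕1 : ∀ a → AllLe (length a) a → Bᴸ (a ⊕ one) ≡ Bᴸ a + exceedLast a
Bᴸ-⊕1 a la = Bᴸ-snoc a (suc (length a)) (All.map s≤s la)

above-++ : ∀ x s b → above x (s ++ b) ≡ above x s + above x b
above-++ x [] b = refl
above-++ x (z ∷ s) b = trans (cong (_ +_) (above-++ x s b)) (sym (+-assoc ⟦ x <ᵇ z ⟧ _ _))

above-none : ∀ x b → All (_≤ x) b → above x b ≡ 0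
above-none x [] _ = refl
above-none x (z ∷ b) (q ∷ qs) = cong₂ _+_ (cong ⟦_⟧ (<ᵇ-false q)) (above-none x b qs)

above-shift : ∀ k x s → above (x + k) (map (_+ k) s) ≡ above x s
above-shift k x [] = refl
above-shift k x (z ∷ s) = cong₂ _+_ (cong ⟦_⟧ (<ᵇ-+ʳ k x z)) (above-shift k x s)

CFrom-shift : ∀ k x s → CFrom (x + k) (map (_+ k) s) ≡ CFrom x s
CFrom-shift k x [] = refl
CFrom-shift k x (y ∷ t) rewrite <ᵇ-+ʳ k y x | above-shift k x t = cong (_ +_) (CFrom-shift k y t)

if-same : ∀ (c : Bool) (n : ℕ) → (if c then n else n) ≡ n
if-same true n = refl
if-same false n = refl

-- Entries of s all exceed k ≥ every entry of b: no occurrence of 21-3 spans both parts.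
CFrom-++-below : ∀ k x s b → k < x → All (k <_) s → AllLe k b →
  CFrom x (s ++ b) ≡ CFrom x s + Cᴸ b
CFrom-++-below k x [] [] _ _ _ = refl
CFrom-++-below k x [] (y ∷ t) kx _ (ly ∷ lt)
  rewrite above-none x t (All.map (λ q → ≤-trans q (<⇒≤ kx)) lt) | if-same (y <ᵇ x) 0 = refl
CFrom-++-below k x (z ∷ s) b kx (kz ∷ ks) lb
  rewrite above-++ x s b | above-none x b (All.map (λ q → ≤-trans q (<⇒≤ kx)) lb)
        | +-identityʳ (above x s) | CFrom-++-below k z s b kz ks lb =
  sym (+-assoc (if z <ᵇ x then above x s else 0) _ _)

Cᴸ-shift-++ : ∀ k a b → AllPos a → AllLe k b → Cᴸ (map (_+ k) a ++ b) ≡ Cᴸ a + Cᴸ b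
Cᴸ-shift-++ k [] b _ _ = refl
Cᴸ-shift-++ k (x ∷ s) b (px ∷ ps) lb =
  trans (CFrom-++-below k (x + k) (map (_+ k) s) b (+-monoˡ-≤ k px)
          (AllP.map⁺ (All.map (+-monoˡ-≤ k) ps)) lb)
    (cong (_+ Cᴸ b) (CFrom-shift k x s))

Cᴸ-⊖ : ∀ a b → AllPos a → AllLe (length b) b → Cᴸ (a ⊖ b) ≡ Cᴸ a + Cᴸ b
Cᴸ-⊖ a b = Cᴸ-shift-++ (length b) a b

Cᴸ-snoc : ∀ a w → All (_< w) a → Cᴸ (a ++ w ∷ []) ≡ Cᴸ a + desᴸ a
Cᴸ-snoc [] w _ = refl
Cᴸ-snoc (x ∷ s) w (px ∷ ps) = go x s px ps
  where
  go : ∀ x s → x < w → All (_< w) s → CFrom x (s ++ w ∷ []) ≡ CFrom x s + desFrom x s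
  go x [] xw _ rewrite <ᵇ-false {w} {x} (<⇒≤ xw) = refl
  go x (y ∷ t) xw (yw ∷ tw) rewrite go y t yw tw | above-++ x t (w ∷ []) | <ᵇ-true xw with y <ᵇ x
  ... | true = solve 3 (λ a b c → (a :+ con 1) :+ (b :+ c) := (a :+ b) :+ (con 1 :+ c)) refl
                 (above x t) (CFrom y t) (desFrom y t)
  ... | false = refl

Cᴸ-⊕1 : ∀ a → AllLe (length a) a → Cᴸ (a ⊕ one) ≡ Cᴸ a + desᴸ a
Cᴸ-⊕1 a la = Cᴸ-snoc a (suc (length a)) (All.map s≤s la)

-- In a ⊖ b with b nonempty, every entry of the shifted a exceeds the last entry.
exceedLast-⊖ : ∀ a b → AllPos a → AllLe (length b) b → 0 < length b →
  exceedLast (a ⊖ b) ≡ length a + exceedLast b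
exceedLast-⊖ [] b _ _ _ = refl
exceedLast-⊖ (x ∷ s) (y ∷ t) (px ∷ ps) lb _ =
  trans (go (x + k) (map (_+ k) s) (big px) (AllP.map⁺ (All.map big ps)))
        (cong (λ n → suc n + exceedLastFrom y t) (length-map (_+ k) s))
  where
  k : ℕ
  k = length (y ∷ t)
  big : ∀ {v} → 1 ≤ v → lastOf y t < v + k
  big q = ≤-trans (s≤s (lastOf-∈ y t lb)) (+-monoˡ-≤ k q)
  go : ∀ x s → lastOf y t < x → All (lastOf y t <_) s →
    exceedLastFrom x (s ++ y ∷ t) ≡ suc (length s) + exceedLastFrom y t
  go x [] q _ rewrite <ᵇ-true q = refl
  go x (z ∷ s) q (qz ∷ qs) rewrite lastOf-++ z s y t | <ᵇ-true q = cong suc (go z s qz qs)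

exceedLast-⊕1 : ∀ a → AllLe (length a) a → exceedLast (a ⊕ one) ≡ 0
exceedLast-⊕1 [] _ = refl
exceedLast-⊕1 (x ∷ s) (px ∷ ps) = go x s (s≤s px) (All.map s≤s ps)
  where
  w : ℕ
  w = suc (length (x ∷ s))
  go : ∀ x s → x < w → All (_< w) s → exceedLastFrom x (s ++ w ∷ []) ≡ 0
  go x [] xw _ rewrite <ᵇ-false {w} {x} (<⇒≤ xw) = refl
  go x (y ∷ t) xw (yw ∷ tw) rewrite lastOf-++ y t w [] | <ᵇ-false {w} {x} (<⇒≤ xw) = go y t yw tw

-- L (a ⊖ (b ⊕ 1)) = |b|: the last entry |b| + 1 exceeds exactly the entries of b.
L-⊖⊕1 : ∀ a b → AllPos a → AllLe (length b) b → L (a ⊖ (b ⊕ one)) ≡ length b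
L-⊖⊕1 a b pa lb = begin
    L (A ++ b ++ m ∷ [])
  ≡⟨ cong L (sym (++-assoc A b (m ∷ []))) ⟩
    L ((A ++ b) ++ m ∷ [])
  ≡⟨ L-snoc (A ++ b) m ⟩
    below m (A ++ b)
  ≡⟨ below-++ A ⟩
    below m A + below m b
  ≡⟨ cong₂ _+_ (below-none A (AllP.map⁺ (All.map big pa))) (below-all b (All.map s≤s lb)) ⟩
    length b ∎
  where
  open ≡-Reasoning
  m : ℕ
  m = suc (length b)
  A : List ℕ
  A = map (_+ length (b ⊕ one)) a
  big : ∀ {v} → 1 ≤ v → m ≤ v + length (b ⊕ one)
  big {v} q = subst (λ k → m ≤ v + k) (sym (length-⊕1 b)) (≤-trans (n≤1+n m) (+-monoˡ-≤ m q))
  below-++ : ∀ s → below m (s ++ b) ≡ below m s + below m b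
  below-++ [] = refl
  below-++ (z ∷ s) = trans (cong (⟦ z <ᵇ m ⟧ +_) (below-++ s)) (sym (+-assoc ⟦ z <ᵇ m ⟧ _ _))
  below-none : ∀ s → All (m ≤_) s → below m s ≡ 0
  below-none [] _ = refl
  below-none (z ∷ s) (q ∷ qs) rewrite <ᵇ-false q = below-none s qs
  below-all : ∀ s → All (_< m) s → below m s ≡ length s
  below-all [] _ = refl
  below-all (z ∷ s) (q ∷ qs) rewrite <ᵇ-true q = cong suc (below-all s qs)

nonempty : List ℕ → ℕ
nonempty [] = 0
nonempty (_ ∷ _) = 1

nonempty-length : ∀ (p q : List ℕ) → length p ≡ length q → nonempty p ≡ nonempty q
nonempty-length [] [] _ = refl
nonempty-length (_ ∷ _) (_ ∷ _) _ = refl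

nonempty-pos : ∀ (p : List ℕ) → 0 < length p → nonempty p ≡ 1
nonempty-pos (_ ∷ _) _ = refl

desᴸ-⊖⊕1 : ∀ a b → AllPos a → AllLe (length b) b →
  desᴸ (a ⊖ (b ⊕ one)) ≡ desᴸ a + nonempty a + desᴸ b
desᴸ-⊖⊕1 a b pa lb = trans (desᴸ-⊖ a (b ⊕ one) pa (AllLe-⊕1 b lb))
  (cong₂ (λ u v → desᴸ a + u + v) (junction a b) (desᴸ-⊕1 b lb))
  where
  junction : ∀ a b → bothNonempty a (b ⊕ one) ≡ nonempty a
  junction [] b = refl
  junction (_ ∷ _) [] = refl
  junction (_ ∷ _) (_ ∷ _) = refl

desᴸ-⊕1⊖ : ∀ a b → AllPos a → AllLe (length a) a → AllLe (length b) b →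
  desᴸ ((a ⊕ one) ⊖ b) ≡ desᴸ a + nonempty b + desᴸ b
desᴸ-⊕1⊖ a b pa la lb = trans (desᴸ-⊖ (a ⊕ one) b (AllPos-⊕1 a pa) lb)
  (cong₂ (λ u v → u + v + desᴸ b) (desᴸ-⊕1 a la) (junction a b))
  where
  junction : ∀ a b → bothNonempty (a ⊕ one) b ≡ nonempty b
  junction [] [] = refl
  junction [] (_ ∷ _) = refl
  junction (_ ∷ _) [] = refl
  junction (_ ∷ _) (_ ∷ _) = refl

Bᴸ-⊖⊕1 : ∀ a b → AllPos a → AllLe (length b) b →
  Bᴸ (a ⊖ (b ⊕ one)) ≡ Bᴸ a + (Bᴸ b + exceedLast b)
Bᴸ-⊖⊕1 a b pa lb =
  trans (Bᴸ-⊖ a (b ⊕ one) pa (AllLe-⊕1 b lb)) (cong (Bᴸ a +_) (Bᴸ-⊕1 b lb))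

Bᴸ-⊕1⊖ : ∀ a b → AllPos a → AllLe (length a) a → AllLe (length b) b →
  Bᴸ ((a ⊕ one) ⊖ b) ≡ Bᴸ a + exceedLast a + Bᴸ b
Bᴸ-⊕1⊖ a b pa la lb =
  trans (Bᴸ-⊖ (a ⊕ one) b (AllPos-⊕1 a pa) lb) (cong (_+ Bᴸ b) (Bᴸ-⊕1 a la))

Cᴸ-⊖⊕1 : ∀ a b → AllPos a → AllLe (length b) b →
  Cᴸ (a ⊖ (b ⊕ one)) ≡ Cᴸ a + (Cᴸ b + desᴸ b)
Cᴸ-⊖⊕1 a b pa lb =
  trans (Cᴸ-⊖ a (b ⊕ one) pa (AllLe-⊕1 b lb)) (cong (Cᴸ a +_) (Cᴸ-⊕1 b lb))

exceedLast-⊖⊕1 : ∀ a b → AllPos a → AllLe (length b) b →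
  exceedLast (a ⊖ (b ⊕ one)) ≡ length a
exceedLast-⊖⊕1 a b pa lb =
  trans (exceedLast-⊖ a (b ⊕ one) pa (AllLe-⊕1 b lb) (length-⊕1-pos b))
  (trans (cong (length a +_) (exceedLast-⊕1 b lb)) (+-identityʳ (length a)))

exceedLast-⊕1⊖ : ∀ a b → AllPos a → AllLe (length a) a → AllLe (length b) b → 0 < length b →
  exceedLast ((a ⊕ one) ⊖ b) ≡ suc (length a) + exceedLast b
exceedLast-⊕1⊖ a b pa la lb b≢[] =
  trans (exceedLast-⊖ (a ⊕ one) b (AllPos-⊕1 a pa) lb b≢[]) (cong (_+ exceedLast b) (length-⊕1 a))

record ψ-Invariant (p q : List ℕ) : Set where
  constructor ψ-inv
  field
    gen       : Gen q
    length≡   : length q ≡ length p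
    des≡      : desᴸ q ≡ desᴸ p
    B-balance : Bᴸ q + desᴸ p ≡ Bᴸ p + exceedLast p

ψ-Invariant-nonempty : ∀ {p q} → ψ-Invariant p q → 0 < length p → 0 < length q
ψ-Invariant-nonempty inv = subst (0 <_) (sym (ψ-Invariant.length≡ inv))

-- exceedLast of 1 ⊖ b = (|b| + 1) ∷ b: the new first entry exceeds the last one
-- exactly when b is nonempty.
exceedLast-one⊖ : ∀ b → AllLe (length b) b → exceedLast (one ⊖ b) ≡ nonempty b + exceedLast b
exceedLast-one⊖ [] _ = refl
exceedLast-one⊖ b@(_ ∷ _) lb = exceedLast-⊕1⊖ [] b [] [] lb (s≤s z≤n)

ψ-case-i-invariant : ∀ {b q} → Gen b → ψ-Invariant b q → ψ-Invariant (one ⊖ b) (one ⊖ q)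
ψ-case-i-invariant {b} {q} gb (ψ-inv gq lq dq bq) =
  ψ-inv (Gen-⊖ (Gen-⊕1 nil) gq) (cong suc lq) descents balance
  where
  open ≡-Reasoning
  descents : desᴸ (one ⊖ q) ≡ desᴸ (one ⊖ b)
  descents = begin
      desᴸ (one ⊖ q)
    ≡⟨ desᴸ-⊕1⊖ [] q [] [] (Gen-le gq) ⟩
      nonempty q + desᴸ q
    ≡⟨ cong₂ _+_ (nonempty-length q b lq) dq ⟩
      nonempty b + desᴸ b
    ≡⟨ desᴸ-⊕1⊖ [] b [] [] (Gen-le gb) ⟨
      desᴸ (one ⊖ b) ∎
  balance : Bᴸ (one ⊖ q) + desᴸ (one ⊖ b) ≡ Bᴸ (one ⊖ b) + exceedLast (one ⊖ b)
  balance = begin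
      Bᴸ (one ⊖ q) + desᴸ (one ⊖ b)
    ≡⟨ cong₂ _+_ (Bᴸ-⊕1⊖ [] q [] [] (Gen-le gq)) (desᴸ-⊕1⊖ [] b [] [] (Gen-le gb)) ⟩
      Bᴸ q + (nonempty b + desᴸ b)
    ≡⟨ x∙yz≈y∙xz (Bᴸ q) (nonempty b) (desᴸ b) ⟩
      nonempty b + (Bᴸ q + desᴸ b)
    ≡⟨ cong (nonempty b +_) bq ⟩
      nonempty b + (Bᴸ b + exceedLast b)
    ≡⟨ x∙yz≈y∙xz (nonempty b) (Bᴸ b) (exceedLast b) ⟩
      Bᴸ b + (nonempty b + exceedLast b)
    ≡⟨ cong₂ _+_ (Bᴸ-⊕1⊖ [] b [] [] (Gen-le gb)) (exceedLast-one⊖ b (Gen-le gb)) ⟨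
      Bᴸ (one ⊖ b) + exceedLast (one ⊖ b) ∎

module ψ-Case-iii {a γ δ : List ℕ} (ga : Gen a) (gγ : Gen γ) (gδ : Gen δ)
  (inv : ψ-Invariant a ((γ ⊕ one) ⊖ δ)) where

  open ψ-Invariant inv using () renaming (length≡ to lq; des≡ to dq; B-balance to bq)
  open ≡-Reasoning
  γ₁ : List ℕ
  γ₁ = γ ⊕ one
  gγ₁ : Gen γ₁
  gγ₁ = Gen-⊕1 gγ
  q : List ℕ
  q = γ₁ ⊖ δ
  lengths : length ((γ₁ ⊕ one) ⊖ δ) ≡ length (a ⊕ one)
  lengths = begin
      length ((γ₁ ⊕ one) ⊖ δ)   ≡⟨ length-⊕1⊖ γ₁ δ ⟩
      suc (length γ₁ + length δ) ≡⟨ cong suc (length-⊖ γ₁ δ) ⟨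
      suc (length q)             ≡⟨ cong suc lq ⟩
      suc (length a)             ≡⟨ length-⊕1 a ⟨
      length (a ⊕ one)           ∎
  descents : desᴸ ((γ₁ ⊕ one) ⊖ δ) ≡ desᴸ (a ⊕ one)
  descents = begin
      desᴸ ((γ₁ ⊕ one) ⊖ δ)
    ≡⟨ desᴸ-⊕1⊖ γ₁ δ (Gen-pos gγ₁) (Gen-le gγ₁) (Gen-le gδ) ⟩
      desᴸ γ₁ + nonempty δ + desᴸ δ
    ≡⟨ cong (λ d → d + nonempty δ + desᴸ δ) (desᴸ-⊕1 γ (Gen-le gγ)) ⟩
      desᴸ γ + nonempty δ + desᴸ δ
    ≡⟨ desᴸ-⊕1⊖ γ δ (Gen-pos gγ) (Gen-le gγ) (Gen-le gδ) ⟨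
      desᴸ q
    ≡⟨ dq ⟩
      desᴸ a
    ≡⟨ desᴸ-⊕1 a (Gen-le ga) ⟨
      desᴸ (a ⊕ one) ∎
  -- Appending a second maximum does not change B: γ₁ ends in its maximum.
  B-unchanged : Bᴸ ((γ₁ ⊕ one) ⊖ δ) ≡ Bᴸ q
  B-unchanged = begin
      Bᴸ ((γ₁ ⊕ one) ⊖ δ)
    ≡⟨ Bᴸ-⊕1⊖ γ₁ δ (Gen-pos gγ₁) (Gen-le gγ₁) (Gen-le gδ) ⟩
      Bᴸ γ₁ + exceedLast γ₁ + Bᴸ δ
    ≡⟨ cong (λ e → Bᴸ γ₁ + e + Bᴸ δ) (exceedLast-⊕1 γ (Gen-le gγ)) ⟩
      Bᴸ γ₁ + 0 + Bᴸ δ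
    ≡⟨ cong (_+ Bᴸ δ) (trans (+-identityʳ (Bᴸ γ₁)) (Bᴸ-⊕1 γ (Gen-le gγ))) ⟩
      Bᴸ γ + exceedLast γ + Bᴸ δ
    ≡⟨ Bᴸ-⊕1⊖ γ δ (Gen-pos gγ) (Gen-le gγ) (Gen-le gδ) ⟨
      Bᴸ q ∎
  balance : Bᴸ ((γ₁ ⊕ one) ⊖ δ) + desᴸ (a ⊕ one) ≡ Bᴸ (a ⊕ one) + exceedLast (a ⊕ one)
  balance = begin
      Bᴸ ((γ₁ ⊕ one) ⊖ δ) + desᴸ (a ⊕ one)
    ≡⟨ cong₂ _+_ B-unchanged (desᴸ-⊕1 a (Gen-le ga)) ⟩
      Bᴸ q + desᴸ a
    ≡⟨ bq ⟩
      Bᴸ a + exceedLast a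
    ≡⟨ Bᴸ-⊕1 a (Gen-le ga) ⟨
      Bᴸ (a ⊕ one)
    ≡⟨ +-identityʳ (Bᴸ (a ⊕ one)) ⟨
      Bᴸ (a ⊕ one) + 0
    ≡⟨ cong (Bᴸ (a ⊕ one) +_) (exceedLast-⊕1 a (Gen-le ga)) ⟨
      Bᴸ (a ⊕ one) + exceedLast (a ⊕ one) ∎

  invariant : ψ-Invariant (a ⊕ one) ((γ₁ ⊕ one) ⊖ δ)
  invariant = ψ-inv (Gen-⊖ (Gen-⊕1 gγ₁) gδ) lengths descents balance

module ψ-Case-ii {a b qa γ δ : List ℕ} (a≢[] : 0 < length a)
  (ga : Gen a) (gb : Gen b) (gγ : Gen γ) (gδ : Gen δ)
  (invᵃ : ψ-Invariant a qa) (invᵇ : ψ-Invariant b (γ ⊖ (δ ⊕ one))) where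

  open ψ-Invariant invᵃ renaming (gen to gqa; length≡ to lqa; des≡ to dqa; B-balance to bqa)
  open ψ-Invariant invᵇ using () renaming (length≡ to lqb; des≡ to dqb; B-balance to bqb)
  open ≡-Reasoning
  Y : List ℕ
  Y = qa ⊖ (δ ⊕ one)
  gY : Gen Y
  gY = Gen-⊖ gqa (Gen-⊕1 gδ)
  length-b : length b ≡ length γ + suc (length δ)
  length-b = trans (sym lqb) (length-⊖⊕1 γ δ)
  length-Y : length Y ≡ length a + suc (length δ)
  length-Y = trans (length-⊖⊕1 qa δ) (cong (_+ suc (length δ)) lqa)
  b≢[] : 0 < length b
  b≢[] = subst (0 <_) (sym length-b) (subst (0 <_) (sym (+-suc (length γ) (length δ))) (s≤s z≤n))
  nonempty-qa : nonempty qa ≡ 1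
  nonempty-qa = trans (nonempty-length qa a lqa) (nonempty-pos a a≢[])
  nonempty-b : nonempty b ≡ 1
  nonempty-b = nonempty-pos b b≢[]
  lengths : length ((Y ⊕ one) ⊖ γ) ≡ length ((a ⊕ one) ⊖ b)
  lengths = begin
      length ((Y ⊕ one) ⊖ γ)
    ≡⟨ length-⊕1⊖ Y γ ⟩
      suc (length Y + length γ)
    ≡⟨ cong (λ n → suc (n + length γ)) length-Y ⟩
      suc (length a + suc (length δ) + length γ)
    ≡⟨ cong suc (xy∙z≈x∙zy (length a) (suc (length δ)) (length γ)) ⟩
      suc (length a + (length γ + suc (length δ)))
    ≡⟨ cong (λ n → suc (length a + n)) length-b ⟨
      suc (length a + length b)
    ≡⟨ length-⊕1⊖ a b ⟨
      length ((a ⊕ one) ⊖ b) ∎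
  des-b : desᴸ b ≡ desᴸ γ + nonempty γ + desᴸ δ
  des-b = trans (sym dqb) (desᴸ-⊖⊕1 γ δ (Gen-pos gγ) (Gen-le gδ))
  descents : desᴸ ((Y ⊕ one) ⊖ γ) ≡ desᴸ ((a ⊕ one) ⊖ b)
  descents = begin
      desᴸ ((Y ⊕ one) ⊖ γ)
    ≡⟨ desᴸ-⊕1⊖ Y γ (Gen-pos gY) (Gen-le gY) (Gen-le gγ) ⟩
      desᴸ Y + nonempty γ + desᴸ γ
    ≡⟨ cong (λ d → d + nonempty γ + desᴸ γ) (desᴸ-⊖⊕1 qa δ (Gen-pos gqa) (Gen-le gδ)) ⟩
      desᴸ qa + nonempty qa + desᴸ δ + nonempty γ + desᴸ γ
    ≡⟨ cong₂ (λ d n → d + n + desᴸ δ + nonempty γ + desᴸ γ) dqa nonempty-qa ⟩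
      desᴸ a + 1 + desᴸ δ + nonempty γ + desᴸ γ
    ≡⟨ solve 4 (λ da dδ nγ dγ → da :+ con 1 :+ dδ :+ nγ :+ dγ := da :+ con 1 :+ (dγ :+ nγ :+ dδ))
         refl (desᴸ a) (desᴸ δ) (nonempty γ) (desᴸ γ) ⟩
      desᴸ a + 1 + (desᴸ γ + nonempty γ + desᴸ δ)
    ≡⟨ cong₂ (λ n d → desᴸ a + n + d) nonempty-b des-b ⟨
      desᴸ a + nonempty b + desᴸ b
    ≡⟨ desᴸ-⊕1⊖ a b (Gen-pos ga) (Gen-le ga) (Gen-le gb) ⟨
      desᴸ ((a ⊕ one) ⊖ b) ∎
  balance-b : Bᴸ γ + (Bᴸ δ + exceedLast δ) + desᴸ b ≡ Bᴸ b + exceedLast b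
  balance-b = trans (cong (_+ desᴸ b) (sym (Bᴸ-⊖⊕1 γ δ (Gen-pos gγ) (Gen-le gδ)))) bqb
  balance : Bᴸ ((Y ⊕ one) ⊖ γ) + desᴸ ((a ⊕ one) ⊖ b) ≡
            Bᴸ ((a ⊕ one) ⊖ b) + exceedLast ((a ⊕ one) ⊖ b)
  balance = begin
      Bᴸ ((Y ⊕ one) ⊖ γ) + desᴸ ((a ⊕ one) ⊖ b)
    ≡⟨ cong₂ _+_ (Bᴸ-⊕1⊖ Y γ (Gen-pos gY) (Gen-le gY) (Gen-le gγ))
                 (desᴸ-⊕1⊖ a b (Gen-pos ga) (Gen-le ga) (Gen-le gb)) ⟩
      Bᴸ Y + exceedLast Y + Bᴸ γ + (desᴸ a + nonempty b + desᴸ b)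
    ≡⟨ cong₂ (λ u v → u + v + Bᴸ γ + (desᴸ a + nonempty b + desᴸ b))
         (Bᴸ-⊖⊕1 qa δ (Gen-pos gqa) (Gen-le gδ))
         (trans (exceedLast-⊖⊕1 qa δ (Gen-pos gqa) (Gen-le gδ)) lqa) ⟩
      Bᴸ qa + (Bᴸ δ + exceedLast δ) + length a + Bᴸ γ + (desᴸ a + nonempty b + desᴸ b)
    ≡⟨ cong (λ n → Bᴸ qa + (Bᴸ δ + exceedLast δ) + length a + Bᴸ γ + (desᴸ a + n + desᴸ b))
         nonempty-b ⟩
      Bᴸ qa + (Bᴸ δ + exceedLast δ) + length a + Bᴸ γ + (desᴸ a + 1 + desᴸ b)
    ≡⟨ solve 8 (λ Bq Bδ eδ la Bγ da db one′ →
           Bq :+ (Bδ :+ eδ) :+ la :+ Bγ :+ (da :+ con 1 :+ db)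
             := (Bq :+ da) :+ (Bγ :+ (Bδ :+ eδ) :+ db) :+ (con 1 :+ la))
         refl (Bᴸ qa) (Bᴸ δ) (exceedLast δ) (length a) (Bᴸ γ) (desᴸ a) (desᴸ b) 0 ⟩
      (Bᴸ qa + desᴸ a) + (Bᴸ γ + (Bᴸ δ + exceedLast δ) + desᴸ b) + suc (length a)
    ≡⟨ cong₂ (λ u v → u + v + suc (length a)) bqa balance-b ⟩
      (Bᴸ a + exceedLast a) + (Bᴸ b + exceedLast b) + suc (length a)
    ≡⟨ solve 5 (λ Ba ea Bb eb la →
           (Ba :+ ea) :+ (Bb :+ eb) :+ (con 1 :+ la) := (Ba :+ ea :+ Bb) :+ ((con 1 :+ la) :+ eb))
         refl (Bᴸ a) (exceedLast a) (Bᴸ b) (exceedLast b) (length a) ⟩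
      (Bᴸ a + exceedLast a + Bᴸ b) + (suc (length a) + exceedLast b)
    ≡⟨ cong₂ _+_ (Bᴸ-⊕1⊖ a b (Gen-pos ga) (Gen-le ga) (Gen-le gb))
                 (exceedLast-⊕1⊖ a b (Gen-pos ga) (Gen-le ga) (Gen-le gb) b≢[]) ⟨
      Bᴸ ((a ⊕ one) ⊖ b) + exceedLast ((a ⊕ one) ⊖ b) ∎

  invariant : ψ-Invariant ((a ⊕ one) ⊖ b) ((Y ⊕ one) ⊖ γ)
  invariant = ψ-inv (Gen-⊖ (Gen-⊕1 gY) gγ) lengths descents balance

ψ-case-invariant : ∀ rec a b → Gen a → Gen b → ψ-Invariant a (rec a) → ψ-Invariant b (rec b) →
  ψ-Invariant ((a ⊕ one) ⊖ b) (ψ-case rec a b)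
ψ-case-invariant rec [] b ga gb _ invᵇ = ψ-case-i-invariant gb invᵇ
ψ-case-invariant rec a@(_ ∷ _) [] ga gb invᵃ _ =
  case-iii (leftSplit (ψ-Invariant.gen invᵃ) (ψ-Invariant-nonempty invᵃ (s≤s z≤n)))
  where
  case-iii : LeftSplit (rec a) → ψ-Invariant ((a ⊕ one) ⊖ []) (ψ-case rec a [])
  case-iii (γ , δ , gγ , gδ , e) =
    subst₂ ψ-Invariant (sym (⊖-identityʳ (a ⊕ one))) (cong rebuild (sym splits))
      (ψ-Case-iii.invariant ga gγ gδ (subst (ψ-Invariant a) e invᵃ))
    where
    rebuild : List ℕ × List ℕ → List ℕ
    rebuild (γ , δ) = ((γ ⊕ one) ⊕ one) ⊖ δ
    splits : decompL (rec a) ≡ (γ , δ)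
    splits = trans (cong decompL e) (decompL-⊕1⊖ γ δ (Gen-le gγ))
ψ-case-invariant rec a@(_ ∷ _) b@(_ ∷ _) ga gb invᵃ invᵇ =
  case-ii (rightSplit (ψ-Invariant.gen invᵇ) (ψ-Invariant-nonempty invᵇ (s≤s z≤n)))
  where
  case-ii : RightSplit (rec b) → ψ-Invariant ((a ⊕ one) ⊖ b) (ψ-case rec a b)
  case-ii (γ , δ , gγ , gδ , e) =
    subst (ψ-Invariant ((a ⊕ one) ⊖ b)) (cong rebuild (sym splits))
      (ψ-Case-ii.invariant (s≤s z≤n) ga gb gγ gδ invᵃ (subst (ψ-Invariant b) e invᵇ))
    where
    rebuild : List ℕ × List ℕ → List ℕ
    rebuild (γ , δ) = ((rec a ⊖ (δ ⊕ one)) ⊕ one) ⊖ γ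
    splits : decompR (rec b) ≡ (γ , δ)
    splits = trans (cong decompR e) (decompR-⊖⊕1 γ δ (Gen-pos gγ) (Gen-le gδ))

ψF-invariant : ∀ f p → Gen p → length p ≤ f → ψ-Invariant p (ψF f p)
ψF-invariant zero [] _ _ = ψ-inv nil refl refl refl
ψF-invariant (suc f) [] _ _ = ψ-inv nil refl refl refl
ψF-invariant (suc f) (x ∷ s) g l with leftSplit g (s≤s z≤n)
... | a , b , ga , gb , e = subst₂ ψ-Invariant (sym e) (sym unfold)
  (ψ-case-invariant (ψF f) a b ga gb
    (ψF-invariant f a ga (≤-trans (m≤m+n (length a) (length b)) parts))
    (ψF-invariant f b gb (≤-trans (m≤n+m (length b) (length a)) parts)))
  where
  parts : length a + length b ≤ f
  parts = ≤-pred (subst (_≤ suc f) (trans (cong length e) (length-⊕1⊖ a b)) l)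
  unfold : ψF (suc f) (x ∷ s) ≡ ψ-case (ψF f) a b
  unfold = cong (λ r → ψ-case (ψF f) (proj₁ r) (proj₂ r))
    (trans (cong decompL e) (decompL-⊕1⊖ a b (Gen-le ga)))

ψ-invariant : ∀ {p} → Gen p → ψ-Invariant p (ψ p)
ψ-invariant {p} g = ψF-invariant (length p) p g ≤-refl

record μ-Invariant (p q : List ℕ) : Set where
  constructor μ-inv
  field
    gen     : Gen q
    length≡ : length q ≡ length p
    C≡B     : Cᴸ q ≡ Bᴸ p
    des≡    : desᴸ q ≡ desᴸ p
    L≡      : L q ≡ L p

-- One unfolding of μ: with x = μ a, q = ψ b and y = μ q,
-- C (x ⊖ (y ⊕ 1)) = C x + C y + des y = B a + B q + des b = B a + B b + exceedLast b
-- = B (a ⊖ (b ⊕ 1)).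
μ-node-invariant : ∀ {a b q x y} → Gen a → Gen b →
  μ-Invariant a x → ψ-Invariant b q → μ-Invariant q y →
  μ-Invariant (a ⊖ (b ⊕ one)) (x ⊖ (y ⊕ one))
μ-node-invariant {a} {b} {q} {x} {y} ga gb
  (μ-inv gx lx cx dx Lx) (ψ-inv gq lq dq bq) (μ-inv gy ly cy dy Ly) =
  μ-inv (node gx gy) lengths C-to-B descents last-entry
  where
  open ≡-Reasoning
  lengths : length (x ⊖ (y ⊕ one)) ≡ length (a ⊖ (b ⊕ one))
  lengths = begin
      length (x ⊖ (y ⊕ one))   ≡⟨ length-⊖⊕1 x y ⟩
      length x + suc (length y) ≡⟨ cong₂ (λ m n → m + suc n) lx (trans ly lq) ⟩
      length a + suc (length b) ≡⟨ length-⊖⊕1 a b ⟨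
      length (a ⊖ (b ⊕ one))   ∎
  C-to-B : Cᴸ (x ⊖ (y ⊕ one)) ≡ Bᴸ (a ⊖ (b ⊕ one))
  C-to-B = begin
      Cᴸ (x ⊖ (y ⊕ one))            ≡⟨ Cᴸ-⊖⊕1 x y (Gen-pos gx) (Gen-le gy) ⟩
      Cᴸ x + (Cᴸ y + desᴸ y)         ≡⟨ cong₂ _+_ cx (cong₂ _+_ cy (trans dy dq)) ⟩
      Bᴸ a + (Bᴸ q + desᴸ b)         ≡⟨ cong (Bᴸ a +_) bq ⟩
      Bᴸ a + (Bᴸ b + exceedLast b)   ≡⟨ Bᴸ-⊖⊕1 a b (Gen-pos ga) (Gen-le gb) ⟨
      Bᴸ (a ⊖ (b ⊕ one))            ∎
  descents : desᴸ (x ⊖ (y ⊕ one)) ≡ desᴸ (a ⊖ (b ⊕ one))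
  descents = begin
      desᴸ (x ⊖ (y ⊕ one))            ≡⟨ desᴸ-⊖⊕1 x y (Gen-pos gx) (Gen-le gy) ⟩
      desᴸ x + nonempty x + desᴸ y     ≡⟨ cong₂ _+_ (cong₂ _+_ dx (nonempty-length x a lx))
                                                    (trans dy dq) ⟩
      desᴸ a + nonempty a + desᴸ b     ≡⟨ desᴸ-⊖⊕1 a b (Gen-pos ga) (Gen-le gb) ⟨
      desᴸ (a ⊖ (b ⊕ one))            ∎
  last-entry : L (x ⊖ (y ⊕ one)) ≡ L (a ⊖ (b ⊕ one))
  last-entry = begin
      L (x ⊖ (y ⊕ one))  ≡⟨ L-⊖⊕1 x y (Gen-pos gx) (Gen-le gy) ⟩
      length y           ≡⟨ trans ly lq ⟩
      length b           ≡⟨ L-⊖⊕1 a b (Gen-pos ga) (Gen-le gb) ⟨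
      L (a ⊖ (b ⊕ one))  ∎

μF-invariant : ∀ f p → Gen p → length p ≤ f → μ-Invariant p (μF f p)
μF-invariant zero [] _ _ = μ-inv nil refl refl refl refl
μF-invariant (suc f) [] _ _ = μ-inv nil refl refl refl refl
μF-invariant (suc f) (x ∷ s) g l with rightSplit g (s≤s z≤n)
... | a , b , ga , gb , e = subst₂ μ-Invariant (sym e) (sym unfold)
  (μ-node-invariant ga gb
    (μF-invariant f a ga (≤-trans (m≤m+n (length a) (length b)) parts))
    invψ
    (μF-invariant f (ψ b) (ψ-Invariant.gen invψ)
      (subst (_≤ f) (sym (ψ-Invariant.length≡ invψ)) (≤-trans (m≤n+m (length b) (length a)) parts))))
  where
  invψ : ψ-Invariant b (ψ b)
  invψ = ψ-invariant gb
  parts : length a + length b ≤ f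
  parts = ≤-pred (subst (_≤ suc f)
    (trans (cong length e) (trans (length-⊖⊕1 a b) (+-suc (length a) (length b)))) l)
  unfold : μF (suc f) (x ∷ s) ≡ μF f a ⊖ (μF f (ψ b) ⊕ one)
  unfold = cong (λ r → μF f (proj₁ r) ⊖ (μF f (ψ (proj₂ r)) ⊕ one))
    (trans (cong decompR e) (decompR-⊖⊕1 a b (Gen-pos ga) (Gen-le gb)))

μ-invariant : ∀ {p} → Gen p → μ-Invariant p (μ p)
μ-invariant {p} g = μF-invariant (length p) p g ≤-refl

-- Occurrences of patterns as subsequences.  Occ₂ y z xs: y occurs in xs
-- before z; Occ₃ x y z xs: x, y, z occur in xs in this order.
data Occ₂ (y z : ℕ) : List ℕ → Set where
  here  : ∀ {xs} → z ∈ xs → Occ₂ y z (y ∷ xs)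
  there : ∀ {w xs} → Occ₂ y z xs → Occ₂ y z (w ∷ xs)

data Occ₃ (x y z : ℕ) : List ℕ → Set where
  here  : ∀ {xs} → Occ₂ y z xs → Occ₃ x y z (x ∷ xs)
  there : ∀ {w xs} → Occ₃ x y z xs → Occ₃ x y z (w ∷ xs)

No132 : List ℕ → Set
No132 xs = ∀ {x y z} → Occ₃ x y z xs → x < z → z < y → ⊥

∈⇒position : ∀ {z xs} → z ∈ xs → Σ ℕ λ k → 1 ≤ k × k ≤ length xs × at xs k ≡ z
∈⇒position (Any.here refl) = 1 , ≤-refl , s≤s z≤n , refl
∈⇒position (Any.there p) with ∈⇒position p
... | suc k , _ , l , e = suc (suc k) , s≤s z≤n , s≤s l , e

Occ₂⇒positions : ∀ {y z xs} → Occ₂ y z xs →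
  Σ ℕ λ j → Σ ℕ λ k → 1 ≤ j × j < k × k ≤ length xs × at xs j ≡ y × at xs k ≡ z
Occ₂⇒positions (here p) with ∈⇒position p
... | suc k , _ , l , e = 1 , suc (suc k) , ≤-refl , s≤s (s≤s z≤n) , s≤s l , refl , e
Occ₂⇒positions (there p) with Occ₂⇒positions p
... | suc j , suc k , _ , jk , l , e₁ , e₂ =
  suc (suc j) , suc (suc k) , s≤s z≤n , s≤s jk , s≤s l , e₁ , e₂

Occ₃⇒positions : ∀ {x y z xs} → Occ₃ x y z xs → Σ ℕ λ i → Σ ℕ λ j → Σ ℕ λ k →
  1 ≤ i × i < j × j < k × k ≤ length xs × at xs i ≡ x × at xs j ≡ y × at xs k ≡ z
Occ₃⇒positions (here p) with Occ₂⇒positions p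
... | suc j , suc k , _ , jk , l , e₁ , e₂ =
  1 , suc (suc j) , suc (suc k) , ≤-refl , s≤s (s≤s z≤n) , s≤s jk , s≤s l , refl , e₁ , e₂
Occ₃⇒positions (there p) with Occ₃⇒positions p
... | suc i , suc j , suc k , _ , ij , jk , l , e₀ , e₁ , e₂ =
  suc (suc i) , suc (suc j) , suc (suc k) , s≤s z≤n , s≤s ij , s≤s jk , s≤s l , e₀ , e₁ , e₂

Avoids132⇒No132 : ∀ π → Avoids132 π → No132 π
Avoids132⇒No132 π av o x<z z<y with Occ₃⇒positions o
... | i , j , k , 1≤i , i<j , j<k , k≤n , e₀ , e₁ , e₂ =
  av (i , j , k , 1≤i , i<j , j<k , k≤n ,
      subst₂ _<_ (sym e₀) (sym e₂) x<z , subst₂ _<_ (sym e₂) (sym e₁) z<y)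

Occ₃-++ˡ : ∀ {x y z xs} ys → Occ₃ x y z xs → Occ₃ x y z (xs ++ ys)
Occ₃-++ˡ ys (here p) = here (Occ₂-++ˡ p)
  where
  Occ₂-++ˡ : ∀ {y z xs} → Occ₂ y z xs → Occ₂ y z (xs ++ ys)
  Occ₂-++ˡ (here p) = here (∈-++⁺ˡ p)
  Occ₂-++ˡ (there p) = there (Occ₂-++ˡ p)
Occ₃-++ˡ ys (there p) = there (Occ₃-++ˡ ys p)

Occ₃-++ʳ : ∀ {x y z ys} xs → Occ₃ x y z ys → Occ₃ x y z (xs ++ ys)
Occ₃-++ʳ [] p = p
Occ₃-++ʳ (w ∷ xs) p = there (Occ₃-++ʳ xs p)

No132-++ˡ : ∀ xs ys → No132 (xs ++ ys) → No132 xs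
No132-++ˡ xs ys av o = av (Occ₃-++ˡ ys o)

No132-++ʳ : ∀ xs ys → No132 (xs ++ ys) → No132 ys
No132-++ʳ xs ys av o = av (Occ₃-++ʳ xs o)

Occ₂-map⁻ : ∀ (g : ℕ → ℕ) {y z} xs → Occ₂ y z (map g xs) →
  Σ ℕ λ y' → Σ ℕ λ z' → Occ₂ y' z' xs × y ≡ g y' × z ≡ g z'
Occ₂-map⁻ g (y' ∷ xs) (here p) with ∈-map⁻ g p
... | z' , z'∈ , e = y' , z' , here z'∈ , refl , e
Occ₂-map⁻ g (w ∷ xs) (there p) with Occ₂-map⁻ g xs p
... | y' , z' , o , e₁ , e₂ = y' , z' , there o , e₁ , e₂

Occ₃-map⁻ : ∀ (g : ℕ → ℕ) {x y z} xs → Occ₃ x y z (map g xs) →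
  Σ ℕ λ x' → Σ ℕ λ y' → Σ ℕ λ z' → Occ₃ x' y' z' xs × x ≡ g x' × y ≡ g y' × z ≡ g z'
Occ₃-map⁻ g (x' ∷ xs) (here p) with Occ₂-map⁻ g xs p
... | y' , z' , o , e₁ , e₂ = x' , y' , z' , here o , refl , e₁ , e₂
Occ₃-map⁻ g (w ∷ xs) (there p) with Occ₃-map⁻ g xs p
... | x' , y' , z' , o , e₀ , e₁ , e₂ = x' , y' , z' , there o , e₀ , e₁ , e₂

No132-map∸ : ∀ m xs → No132 xs → No132 (map (_∸ m) xs)
No132-map∸ m xs av o x<z z<y with Occ₃-map⁻ (_∸ m) xs o
... | x' , y' , z' , o' , refl , refl , refl = av o' (∸-cancel-< x<z) (∸-cancel-< z<y)
  where
  ∸-cancel-< : ∀ {u v} → u ∸ m < v ∸ m → u < v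
  ∸-cancel-< h = ≰⇒> (λ v≤u → <⇒≱ h (∸-monoˡ-≤ m v≤u))

Occ₂-snoc : ∀ {x y m xs} → Occ₂ x y xs → Occ₃ x y m (xs ++ m ∷ [])
Occ₂-snoc (here p) = here (∈⇒Occ₂ p)
  where
  ∈⇒Occ₂ : ∀ {y m xs} → y ∈ xs → Occ₂ y m (xs ++ m ∷ [])
  ∈⇒Occ₂ {xs = _ ∷ rest} (Any.here refl) = here (∈-++⁺ʳ rest (Any.here refl))
  ∈⇒Occ₂ (Any.there p) = there (∈⇒Occ₂ p)
Occ₂-snoc (there p) = there (Occ₂-snoc p)

range : ℕ → ℕ → List ℕ
range s zero = []
range s (suc k) = s ∷ range (suc s) k

map-suc-applyUpTo : ∀ (f : ℕ → ℕ) s n → (∀ i → suc (f i) ≡ s + i) →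
  map suc (applyUpTo f n) ≡ range s n
map-suc-applyUpTo f s zero e = refl
map-suc-applyUpTo f s (suc n) e = cong₂ _∷_ (trans (e 0) (+-identityʳ s))
  (map-suc-applyUpTo (f ∘ suc) (suc s) n (λ i → trans (e (suc i)) (+-suc s i)))

upTo-range : ∀ n → map suc (upTo n) ≡ range 1 n
upTo-range n = map-suc-applyUpTo (λ i → i) 1 n (λ _ → refl)

range-+ : ∀ s a b → range s (a + b) ≡ range s a ++ range (s + a) b
range-+ s zero b = cong (λ t → range t b) (sym (+-identityʳ s))
range-+ s (suc a) b = cong (s ∷_)
  (trans (range-+ (suc s) a b) (cong (λ t → range (suc s) a ++ range t b) (sym (+-suc s a))))

range-≥ : ∀ s k → All (s ≤_) (range s k)
range-≥ s zero = []
range-≥ s (suc k) = ≤-refl ∷ All.map (≤-trans (n≤1+n s)) (range-≥ (suc s) k)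

range-< : ∀ s k → All (_< s + k) (range s k)
range-< s zero = []
range-< s (suc k) = subst (λ t → All (_< t) (range s (suc k))) (sym (+-suc s k))
  (s≤s (m≤m+n s k) ∷ range-< (suc s) k)

length-range : ∀ s k → length (range s k) ≡ k
length-range s zero = refl
length-range s (suc k) = cong suc (length-range (suc s) k)

map-∸-range : ∀ m s k → map (_∸ m) (range (s + m) k) ≡ range s k
map-∸-range m s zero = refl
map-∸-range m s (suc k) = cong₂ _∷_ (m+n∸n≡m s m) (map-∸-range m (suc s) k)

range-around : ∀ {m n} → 1 ≤ m → m ≤ n →
  range 1 n ≡ range 1 (m ∸ 1) ++ m ∷ range (suc m) (n ∸ m)
range-around {suc m'} {n} _ m≤n = begin
    range 1 n                               ≡⟨ cong (range 1) (m+[n∸m]≡n m≤n) ⟨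
    range 1 (suc m' + (n ∸ suc m'))         ≡⟨ cong (range 1) (sym (+-suc m' (n ∸ suc m'))) ⟩
    range 1 (m' + suc (n ∸ suc m'))         ≡⟨ range-+ 1 m' (suc (n ∸ suc m')) ⟩
    range 1 m' ++ range (suc m') (suc (n ∸ suc m')) ∎
  where open ≡-Reasoning

last-∉ : ∀ xs m → Unique (xs ++ m ∷ []) → m ∉ xs
last-∉ xs m u = Unique[x∷xs]⇒x∉xs (Unique-resp-↭ (↭⇒↭ₛ (↭-sym (∷↭∷ʳ m xs))) u)

above-then-below : ∀ m xs → m ∉ xs → (∀ {x y} → Occ₂ x y xs → x < m → m < y → ⊥) →
  xs ≡ filterᵇ (m <ᵇ_) xs ++ filterᵇ (_<ᵇ m) xs
above-then-below m [] _ _ = refl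
above-then-below m (x ∷ xs) m∉ no-xmy with <-cmp x m
... | tri< x<m _ _ = sym (cong₂ _++_
    (trans (filter-reject (λ v → T? (m <ᵇ v)) {x} {xs} (<⇒≯ x<m ∘ <ᵇ⇒< m x))
           (filter-above-none m (All.map <⇒≤ rest-below)))
    (trans (filter-accept (λ v → T? (v <ᵇ m)) {x} {xs} (<⇒<ᵇ x<m))
           (cong (x ∷_) (filter-below-all m rest-below))))
  where
  rest-below : All (_< m) xs
  rest-below = All.tabulate λ {y} y∈ →
    ≤∧≢⇒< (≮⇒≥ (no-xmy (here y∈) x<m)) (λ y≡m → m∉ (Any.there (subst (_∈ xs) y≡m y∈)))
... | tri≈ _ x≡m _ = ⊥-elim (m∉ (Any.here (sym x≡m)))
... | tri> _ _ m<x = trans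
    (cong (x ∷_) (above-then-below m xs (m∉ ∘ Any.there) (no-xmy ∘ there)))
    (sym (cong₂ _++_ (filter-accept (λ v → T? (m <ᵇ v)) {x} {xs} (<⇒<ᵇ m<x))
                     (filter-reject (λ v → T? (v <ᵇ m)) {x} {xs} (<⇒≯ m<x ∘ <ᵇ⇒< x m))))

filter-around-↭ : ∀ {xs m lo hi} → xs ++ m ∷ [] ↭ lo ++ m ∷ hi →
  All (_< m) lo → All (m <_) hi →
  filterᵇ (m <ᵇ_) xs ↭ hi × filterᵇ (_<ᵇ m) xs ↭ lo
filter-around-↭ {xs} {m} {lo} {hi} p lo<m m<hi =
  subst₂ _↭_ (drop-last (m <ᵇ_) m≮m) upper (filter-↭ (λ v → T? (m <ᵇ v)) p) ,
  subst₂ _↭_ (drop-last (_<ᵇ m) m≮m) lower (filter-↭ (λ v → T? (v <ᵇ m)) p)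
  where
  m≮m : ¬ T (m <ᵇ m)
  m≮m = n≮n m ∘ <ᵇ⇒< m m
  drop-last : ∀ (test : ℕ → Bool) → ¬ T (test m) →
    filterᵇ test (xs ++ m ∷ []) ≡ filterᵇ test xs
  drop-last test ¬t = trans (filterᵇ-++ test xs (m ∷ []))
    (trans (cong (filterᵇ test xs ++_) (filter-reject (T? ∘ test) {m} {[]} ¬t)) (++-identityʳ _))
  upper : filterᵇ (m <ᵇ_) (lo ++ m ∷ hi) ≡ hi
  upper = trans (filterᵇ-++ (m <ᵇ_) lo (m ∷ hi))
    (cong₂ _++_ (filter-above-none m (All.map <⇒≤ lo<m))
                (trans (filter-reject (λ v → T? (m <ᵇ v)) {m} {hi} m≮m) (filter-above-all m m<hi)))
  lower : filterᵇ (_<ᵇ m) (lo ++ m ∷ hi) ≡ lo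
  lower = trans (filterᵇ-++ (_<ᵇ m) lo (m ∷ hi))
    (trans (cong₂ _++_ (filter-below-all m lo<m) (filter-below-none m (≤-refl ∷ All.map <⇒≤ m<hi)))
           (++-identityʳ lo))

last-in-range : ∀ {xs m n} → xs ++ m ∷ [] ↭ range 1 n → 1 ≤ m × m ≤ n
last-in-range {xs} {m} {n} p = All.lookup (range-≥ 1 n) m∈ , ≤-pred (All.lookup (range-< 1 n) m∈)
  where
  m∈ : m ∈ range 1 n
  m∈ = ∈-resp-↭ p (∈-++⁺ʳ xs (Any.here refl))

map-∸-+ : ∀ m xs → All (m ≤_) xs → map (_+ m) (map (_∸ m) xs) ≡ xs
map-∸-+ m [] _ = refl
map-∸-+ m (x ∷ xs) (q ∷ qs) = cong₂ _∷_ (m∸n+n≡m q) (map-∸-+ m xs qs)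

-- The decomposition step: a 132-avoiding arrangement of range 1 n ending in
-- m = m' + 1 is α ⊖ (Q ⊕ 1), where Q (the entries below m) and α (the entries
-- above m, shifted down by m) are 132-avoiding arrangements of smaller ranges.
decompose-at-last : ∀ {n} π' m' → π' ++ suc m' ∷ [] ↭ range 1 n → No132 (π' ++ suc m' ∷ []) →
  Σ (List ℕ) λ α → Σ (List ℕ) λ Q →
    (α ↭ range 1 (n ∸ suc m')) × No132 α × (Q ↭ range 1 m') × No132 Q ×
    (π' ++ suc m' ∷ [] ≡ α ⊖ (Q ⊕ one))
decompose-at-last {n} π' m' p av =
  α , Q , subst (α ↭_) (map-∸-range m 1 k) (map⁺ (_∸ m) pP) , No132-map∸ m P (No132-++ˡ P _ av′) ,
  pQ , No132-++ˡ Q (m ∷ []) (No132-++ʳ P _ av′) , shape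
  where
  m : ℕ
  m = suc m'
  k : ℕ
  k = n ∸ m
  lo : List ℕ
  lo = range 1 m'
  hi : List ℕ
  hi = range (suc m) k
  P : List ℕ
  P = filterᵇ (m <ᵇ_) π'
  Q : List ℕ
  Q = filterᵇ (_<ᵇ m) π'
  α : List ℕ
  α = map (_∸ m) P
  m∉ : m ∉ π'
  m∉ = last-∉ π' m (Unique-resp-↭ (↭⇒↭ₛ (↭-sym p)) distinct)
    where
    distinct : Unique (range 1 n)
    distinct = subst Unique (upTo-range n) (Unique.map⁺ suc-injective (upTo⁺ n))
  arranged : π' ++ m ∷ [] ↭ lo ++ m ∷ hi
  arranged = subst (_ ↭_) (range-around (s≤s z≤n) (proj₂ (last-in-range p))) p
  pP : P ↭ hi
  pP = proj₁ (filter-around-↭ arranged (range-< 1 m') (range-≥ (suc m) k))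
  pQ : Q ↭ lo
  pQ = proj₂ (filter-around-↭ arranged (range-< 1 m') (range-≥ (suc m) k))
  reordered : π' ++ m ∷ [] ≡ P ++ (Q ++ m ∷ [])
  reordered = trans (cong (_++ m ∷ []) (above-then-below m π' m∉ (av ∘ Occ₂-snoc)))
                    (++-assoc P Q (m ∷ []))
  av′ : No132 (P ++ (Q ++ m ∷ []))
  av′ = subst No132 reordered av
  length-Q : length Q ≡ m'
  length-Q = trans (↭-length pQ) (length-range 1 m')
  P-above : All (m ≤_) P
  P-above = All.map <⇒≤ (All-resp-↭ (↭-sym pP) (range-≥ (suc m) k))
  shape : π' ++ m ∷ [] ≡ α ⊖ (Q ⊕ one)
  shape = trans reordered (cong₂ (λ u v → u ++ (Q ++ v ∷ [])) (sym unshift) (cong suc (sym length-Q)))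
    where
    unshift : map (_+ length (Q ⊕ one)) α ≡ P
    unshift = trans (cong (λ j → map (_+ j) α) (trans (length-⊕1 Q) (cong suc length-Q)))
                    (map-∸-+ m P P-above)

No132⇒Gen : ∀ f n π → n ≤ f → π ↭ range 1 n → No132 π → Gen π
No132⇒Gen f zero π _ p _ = subst Gen (sym (↭-empty-inv p)) nil
No132⇒Gen (suc f) (suc n') π (s≤s n'≤f) p av with initLast π
... | [] with () ← ↭-length p
... | π' ∷ʳ′ zero with () ← proj₁ (last-in-range p)
... | π' ∷ʳ′ suc m' with s≤s m'≤n' ← proj₂ (last-in-range p) | decompose-at-last π' m' p av
...   | α , Q , pα , avα , pQ , avQ , shape = subst Gen (sym shape)
  (node (No132⇒Gen f (n' ∸ m') α (≤-trans (m∸n≤m n' m') n'≤f) pα avα)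
        (No132⇒Gen f m' Q (≤-trans m'≤n' n'≤f) pQ avQ))

theorem3 : (n : ℕ) (π : List ℕ) → IsPerm n π → Avoids132 π →
    (C (μ π) , des (μ π) , L (μ π)) ≡ (B π , des π , L π)
theorem3 n π perm avoids = cong₂ _,_ C-to-B (cong₂ _,_ descents (μ-Invariant.L≡ inv))
  where
  generated : Gen π
  generated = No132⇒Gen n n π ≤-refl (subst (π ↭_) (upTo-range n) perm) (Avoids132⇒No132 π avoids)
  inv : μ-Invariant π (μ π)
  inv = μ-invariant generated
  C-to-B : C (μ π) ≡ B π
  C-to-B = trans (C≡Cᴸ (μ π)) (trans (μ-Invariant.C≡B inv) (sym (B≡Bᴸ π)))
  descents : des (μ π) ≡ des π
  descents = trans (des≡desᴸ (μ π)) (trans (μ-Invariant.des≡ inv) (sym (des≡desᴸ π)))
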